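{- Let $q$ be a prime power and $n\ge 1$. Let $\mathcal O_1$ and $\mathcal O_2$ be two elementary $n$-dimensional pseudo-ovals in ${\rm PG}(3n-1,q)$ arising (via the same field-reduction identification) from the ovals $\widehat{\mathcal O}_1$ and $\widehat{\mathcal O}_2$ of ${\rm PG}(2,q^n)$, respectively. Then $\mathcal O_1$ and $\mathcal O_2$ are projectively equivalent (i.e. lie in the same orbit of ${\rm P\Gamma L}(3n,q)$) if and only if $\widehat{\mathcal O}_1$ and $\widehat{\mathcal O}_2$ are projectively equivalent (i.e. lie in the same orbit of ${\rm P\Gamma L}(3,q^n)$).
   Context: An oval of ${\rm PG}(2,q)$ is a set of $q+1$ points, no three collinear. An $n$-dimensional pseudo-oval in ${\rm PG}(3n-1,q)$ is a set of $q^n+1$ subspaces of projective dimension $n-1$ such that any three of them span ${\rm PG}(3n-1,q)$. Identifying the underlying vector space ${\rm GF}(q)^{3n}$ of ${\rm PG}(3n-1,q)$ with ${\rm GF}(q^n)^3$ regarded as a ${\rm GF}(q)$-vector space (field reduction), each point of ${\rm PG}(2,q^n)$ (a 1-dimensional ${\rm GF}(q^n)$-subspace) becomes an $(n-1)$-dimensional projective subspace of ${\rm PG}(3n-1,q)$; the image of an oval of ${\rm PG}(2,q^n)$ is then an $n$-dimensional pseudo-oval, and pseudo-ovals obtained this way are called elementary (arising from that oval). -}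

module Defs where

open import Level using (0ℓ)
open import Data.Nat as ℕ using (ℕ; _^_)
open import Data.Fin using (Fin)
open import Data.Product using (_×_; _,_; ∃; ∃-syntax; Σ-syntax)
open import Relation.Binary.PropositionalEquality using (_≡_; _≢_)
open import Relation.Nullary using (¬_)
open import Algebra.Structures using (IsCommutativeRing)
open import Function.Definitions using (Bijective)

record Field : Set₁ where
  infixl 6 _+_
  infixl 7 _*_
  field
    Carrier : Set
    _+_ _*_ : Carrier → Carrier → Carrier
    -_      : Carrier → Carrier
    0# 1#   : Carrier
    isCommutativeRing : IsCommutativeRing _≡_ _+_ _*_ -_ 0# 1#
    0≢1     : 0# ≢ 1#
    inverse : ∀ x → x ≢ 0# → ∃[ y ] (x * y ≡ 1#)

record IsFieldAutomorphism (K : Field) (σ : Field.Carrier K → Field.Carrier K) : Set where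
  open Field K
  field
    bijective : Bijective _≡_ _≡_ σ
    pres-+    : ∀ a b → σ (a + b) ≡ σ a + σ b
    pres-*    : ∀ a b → σ (a * b) ≡ σ a * σ b

record IsFieldHom (F E : Field) (ι : Field.Carrier F → Field.Carrier E) : Set where
  private
    module F = Field F
    module E = Field E
  field
    pres-+ : ∀ a b → ι (a F.+ b) ≡ ι a E.+ ι b
    pres-* : ∀ a b → ι (a F.* b) ≡ ι a E.* ι b
    pres-1 : ι F.1# ≡ E.1#

-- Projective geometry over E = GF(q^n), with GF(q) = F embedded via ι.
-- The vector space GF(q^n)^3 is V = E × E × E; regarded as an F-vector
-- space (via ι) it is the underlying space GF(q)^{3n} of PG(3n-1,q).

module Geometry (F E : Field) (ι : Field.Carrier F → Field.Carrier E) where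
  private
    module F = Field F
    module E = Field E

  V : Set
  V = E.Carrier × E.Carrier × E.Carrier

  0V : V
  0V = E.0# , E.0# , E.0#

  _⊕_ : V → V → V
  (x₁ , x₂ , x₃) ⊕ (y₁ , y₂ , y₃) = (x₁ E.+ y₁) , (x₂ E.+ y₂) , (x₃ E.+ y₃)

  _•_ : E.Carrier → V → V
  λ' • (x₁ , x₂ , x₃) = (λ' E.* x₁) , (λ' E.* x₂) , (λ' E.* x₃)

  _·_ : F.Carrier → V → V
  a · x = ι a • x

  -- Points of PG(2,q^n) are represented by nonzero vectors; u and v
  -- represent the same point iff v is a GF(q^n)-multiple of u.
  SamePoint : V → V → Set
  SamePoint u v = ∃[ λ' ] (v ≡ λ' • u)

  OnLine : V → V → Set
  OnLine (a , b , c) (x , y , z) = (a E.* x) E.+ (b E.* y) E.+ (c E.* z) ≡ E.0#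

  Collinear : V → V → V → Set
  Collinear u v w = ∃[ ℓ ] (ℓ ≢ 0V × OnLine ℓ u × OnLine ℓ v × OnLine ℓ w)

  -- An oval of PG(2,q^n): q^n + 1 pairwise distinct points, no three collinear.
  -- (q is the order of F, n the degree; the point set is given by an
  -- indexing Fin (q ^ n ℕ.+ 1) → V.)
  record IsOval (q n : ℕ) (O : Fin (q ^ n ℕ.+ 1) → V) : Set where
    field
      nonzero    : ∀ i → O i ≢ 0V
      distinct   : ∀ i j → i ≢ j → ¬ SamePoint (O i) (O j)
      noThreeCol : ∀ i j k → i ≢ j → i ≢ k → j ≢ k → ¬ Collinear (O i) (O j) (O k)

  record IsSemilinearE (τ : E.Carrier → E.Carrier) (g : V → V) : Set where
    field
      automorphism : IsFieldAutomorphism E τ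
      bijective    : Bijective _≡_ _≡_ g
      additive     : ∀ x y → g (x ⊕ y) ≡ g x ⊕ g y
      semilinear   : ∀ λ' x → g (λ' • x) ≡ τ λ' • g x

  OvalEquivalent : ∀ {m} → (Fin m → V) → (Fin m → V) → Set
  OvalEquivalent O₁ O₂ =
    ∃[ τ ] ∃[ g ] (IsSemilinearE τ g
      × (∀ i → ∃[ j ] SamePoint (g (O₁ i)) (O₂ j))
      × (∀ j → ∃[ i ] SamePoint (g (O₁ i)) (O₂ j)))

  -- Field reduction: the point <v> of PG(2,q^n) becomes the GF(q)-subspace
  -- { λ v : λ ∈ GF(q^n) } of V, an (n-1)-space of PG(3n-1,q).
  Subspace : Set₁
  Subspace = V → Set

  fieldReduction : V → Subspace
  fieldReduction v x = ∃[ λ' ] (x ≡ λ' • v)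

  elementaryPseudoOval : ∀ {m} → (Fin m → V) → Fin m → Subspace
  elementaryPseudoOval O i = fieldReduction (O i)

  record IsSemilinearF (σ : F.Carrier → F.Carrier) (φ : V → V) : Set where
    field
      automorphism : IsFieldAutomorphism F σ
      bijective    : Bijective _≡_ _≡_ φ
      additive     : ∀ x y → φ (x ⊕ y) ≡ φ x ⊕ φ y
      semilinear   : ∀ a x → φ (a · x) ≡ σ a · φ x

  MapsOnto : (V → V) → Subspace → Subspace → Set
  MapsOnto φ U W = (∀ x → U x → W (φ x)) × (∀ y → W y → ∃[ x ] (U x × φ x ≡ y))

  SubspaceSetEquivalent : ∀ {m} → (Fin m → Subspace) → (Fin m → Subspace) → Set
  SubspaceSetEquivalent 𝒪₁ 𝒪₂ =
    ∃[ σ ] ∃[ φ ] (IsSemilinearF σ φ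
      × (∀ i → ∃[ j ] MapsOnto φ (𝒪₁ i) (𝒪₂ j))
      × (∀ j → ∃[ i ] MapsOnto φ (𝒪₁ i) (𝒪₂ j)))

-- An F-semilinear bijection φ of V = E³ carrying the field reductions ⟨O₁ i⟩ onto field
-- reductions ⟨O₂ j⟩ is already E-semilinear. Take a frame e₁, e₂, e₃, e₁ + e₂ + e₃ of oval
-- points: φ scales each ⟨eᵢ⟩ and the unit point, and comparing the scalars shows
-- φ(a e₁ + b e₂ + c e₃) = τa φe₁ + τb φe₂ + τc φe₃ for one additive bijection τ of E. Each further
-- oval point a e₁ + b e₂ + c e₃ makes τ multiplicative at b/a; as no three oval points are
-- collinear these q^n - 2 ratios are distinct and nonzero, and since the set of elements at which τ
-- is multiplicative contains 0 and is closed under y ↦ y + 1, it is all of E. (When |E| = 2 every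
-- additive map is E-linear.) Conversely, an E-semilinear map with automorphism τ is F-semilinear,
-- because τ preserves the subfield F, the set of roots of X^q - X.

module Submission where

open import Level using (0ℓ)
open import Defs
open import Data.Nat as ℕ using (ℕ; zero; suc)
import Data.Nat.Properties as ℕ
open import Data.Integer as ℤ using (ℤ; -[1+_]; _⊖_; _◃_; sign; ∣_∣)
import Data.Integer.Properties as ℤ
import Data.Sign as Sign
open import Data.Fin as Fin using (Fin; zero; suc)
import Data.Fin.Properties as Fin
open import Data.Fin.Patterns using (0F; 1F; 2F; 3F)
open import Data.Fin.Permutation using (Permutation)
open import Data.Vec.Functional using (Vector; _∷_; replicate; removeAt)
open import Data.Product using (_×_; _,_; ∃-syntax; proj₁; proj₂)
import Data.Product.Properties as Product
open import Data.Sum as Sum using (_⊎_; inj₁; inj₂)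
open import Data.Maybe using (Maybe; just; nothing)
open import Data.Empty using (⊥-elim)
open import Function.Base using (_∘_)
open import Function.Bundles using (_↔_; _⇔_; Inverse; Injection; mk⇔; mk↔ₛ′)
open import Function.Definitions using (Injective; Bijective)
open import Function.Properties.Inverse using (↔⇒↣; ↔-sym)
open import Relation.Binary.Definitions using (DecidableEquality)
open import Relation.Binary.PropositionalEquality as ≡ using (_≡_; _≢_)
open import Relation.Nullary using (¬_; yes; no)
open import Relation.Nullary.Decidable using (via-injection; decidable-stable)
open import Algebra.Bundles using (CommutativeRing; RawRing)
import Algebra.Properties.Ring as RingProperties
import Algebra.Properties.Semiring.Mult as SemiringMult
import Algebra.Properties.AbelianGroup as AbelianGroupProperties
import Algebra.Properties.CommutativeSemigroup as CommutativeSemigroupProperties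
import Algebra.Properties.CommutativeMonoid.Sum as CommutativeMonoidSum
open import Algebra.Solver.Ring.AlmostCommutativeRing using (_-Raw-AlmostCommutative⟶_; fromCommutativeRing)

-- The ring solver needs coefficients whose equality computes: integers, cast into R.
module IntegerCast {c ℓ} (R : CommutativeRing c ℓ) where

  open CommutativeRing R
  open RingProperties ring using (-‿involutive; -0#≈0#; -1*x≈-x)
  open AbelianGroupProperties +-abelianGroup using (⁻¹-∙-comm)
  open SemiringMult semiring using (×-homo-+; ×1-homo-*) renaming (_×_ to _·_)
  module + = CommutativeSemigroupProperties +-commutativeSemigroup
  module * = CommutativeSemigroupProperties *-commutativeSemigroup
  open import Relation.Binary.Reasoning.Setoid setoid

  cast : ℤ → Carrier
  cast (ℤ.+ n)  = n · 1#
  cast -[1+ n ] = - (suc n · 1#)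

  private
    signCast : Sign.Sign → Carrier
    signCast Sign.+ = 1#
    signCast Sign.- = - 1#

    signCast-* : ∀ s t → signCast (s Sign.* t) ≈ signCast s * signCast t
    signCast-* Sign.- Sign.- = sym (trans (-1*x≈-x (- 1#)) (-‿involutive 1#))
    signCast-* Sign.- Sign.+ = sym (*-identityʳ _)
    signCast-* Sign.+ t      = sym (*-identityˡ _)

    cast-◃ : ∀ s n → cast (s ◃ n) ≈ signCast s * (n · 1#)
    cast-◃ s      zero    = sym (zeroʳ _)
    cast-◃ Sign.- (suc n) = sym (-1*x≈-x _)
    cast-◃ Sign.+ (suc n) = sym (*-identityˡ _)

    cast-signAbs : ∀ i → cast i ≈ signCast (sign i) * (∣ i ∣ · 1#)
    cast-signAbs i = trans (reflexive (≡.cong cast (≡.sym (ℤ.◃-inverse i)))) (cast-◃ (sign i) ∣ i ∣)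

    1+x-[1+y]≈x-y : ∀ x y → (1# + x) - (1# + y) ≈ x - y
    1+x-[1+y]≈x-y x y = begin
      (1# + x) + - (1# + y)      ≈⟨ +-congˡ (⁻¹-∙-comm 1# y) ⟨
      (1# + x) + (- 1# + - y)    ≈⟨ +.interchange 1# x (- 1#) (- y) ⟩
      (1# + - 1#) + (x + - y)    ≈⟨ +-congʳ (-‿inverseʳ 1#) ⟩
      0# + (x + - y)             ≈⟨ +-identityˡ _ ⟩
      x - y                      ∎

    cast-⊖ : ∀ m n → cast (m ⊖ n) ≈ m · 1# - n · 1#
    cast-⊖ zero    zero    = sym (trans (+-identityˡ _) -0#≈0#)
    cast-⊖ zero    (suc n) = sym (+-identityˡ _)
    cast-⊖ (suc m) zero    = sym (trans (+-congˡ -0#≈0#) (+-identityʳ _))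
    cast-⊖ (suc m) (suc n) = begin
      cast (suc m ⊖ suc n)         ≡⟨ ≡.cong cast (ℤ.[1+m]⊖[1+n]≡m⊖n m n) ⟩
      cast (m ⊖ n)                 ≈⟨ cast-⊖ m n ⟩
      m · 1# - n · 1#              ≈⟨ 1+x-[1+y]≈x-y _ _ ⟨
      suc m · 1# - suc n · 1#      ∎

  cast-+ : ∀ i j → cast (i ℤ.+ j) ≈ cast i + cast j
  cast-+ -[1+ m ] -[1+ n ] = begin
    - (suc (suc (m ℕ.+ n)) · 1#)     ≡⟨ ≡.cong (λ k → - (suc k · 1#)) (≡.sym (ℕ.+-suc m n)) ⟩
    - ((suc m ℕ.+ suc n) · 1#)       ≈⟨ -‿cong (×-homo-+ 1# (suc m) (suc n)) ⟩
    - (suc m · 1# + suc n · 1#)      ≈⟨ ⁻¹-∙-comm _ _ ⟨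
    - (suc m · 1#) + - (suc n · 1#)  ∎
  cast-+ -[1+ m ] (ℤ.+ n)  = trans (cast-⊖ n (suc m)) (+-comm _ _)
  cast-+ (ℤ.+ m)  -[1+ n ] = cast-⊖ m (suc n)
  cast-+ (ℤ.+ m)  (ℤ.+ n)  = ×-homo-+ 1# m n

  cast-* : ∀ i j → cast (i ℤ.* j) ≈ cast i * cast j
  cast-* i j = begin
    cast (i ℤ.* j)
      ≈⟨ cast-◃ (sign i Sign.* sign j) (∣ i ∣ ℕ.* ∣ j ∣) ⟩
    signCast (sign i Sign.* sign j) * ((∣ i ∣ ℕ.* ∣ j ∣) · 1#)
      ≈⟨ *-cong (signCast-* (sign i) (sign j)) (×1-homo-* ∣ i ∣ ∣ j ∣) ⟩
    (signCast (sign i) * signCast (sign j)) * ((∣ i ∣ · 1#) * (∣ j ∣ · 1#))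
      ≈⟨ *.interchange _ _ _ _ ⟩
    (signCast (sign i) * (∣ i ∣ · 1#)) * (signCast (sign j) * (∣ j ∣ · 1#))
      ≈⟨ *-cong (cast-signAbs i) (cast-signAbs j) ⟨
    cast i * cast j
      ∎

  cast-neg : ∀ i → cast (ℤ.- i) ≈ - cast i
  cast-neg -[1+ n ]      = sym (-‿involutive _)
  cast-neg (ℤ.+ zero)    = sym -0#≈0#
  cast-neg (ℤ.+ (suc n)) = refl

  homomorphism : ℤ.+-*-rawRing -Raw-AlmostCommutative⟶ fromCommutativeRing R
  homomorphism = record
    { ⟦_⟧ = cast ; +-homo = cast-+ ; *-homo = cast-* ; -‿homo = cast-neg
    ; 0-homo = refl ; 1-homo = +-identityʳ 1# }

  cast-≟ : ∀ i j → Maybe (cast i ≈ cast j)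
  cast-≟ i j with i ℤ.≟ j
  ... | yes ≡.refl = just refl
  ... | no _       = nothing

  open import Algebra.Solver.Ring ℤ.+-*-rawRing (fromCommutativeRing R) homomorphism cast-≟ public
    using (solve; _:=_; _:+_; _:*_; :-_; _:-_; con; Polynomial)

  polynomialRawRing : ℕ → RawRing 0ℓ 0ℓ
  polynomialRawRing n = record
    { Carrier = Polynomial n ; _≈_ = _≡_ ; _+_ = _:+_ ; _*_ = _:*_ ; -_ = :-_
    ; 0# = con (ℤ.+ 0) ; 1# = con (ℤ.+ 1) }

-- Written over an arbitrary raw ring so that, instantiated at the solver's polynomial syntax,
-- the same formulas can be handed to solve.
module CoordinateFormulas (R : RawRing 0ℓ 0ℓ) where
  open RawRing R

  Point : Set
  Point = Carrier × Carrier × Carrier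

  infixl 6 _⊞_ _-_
  infixr 7 _⊡_

  _-_ : Carrier → Carrier → Carrier
  x - y = x + - y

  _⊞_ : Point → Point → Point
  (x₁ , x₂ , x₃) ⊞ (y₁ , y₂ , y₃) = x₁ + y₁ , x₂ + y₂ , x₃ + y₃

  _⊡_ : Carrier → Point → Point
  a ⊡ (x₁ , x₂ , x₃) = a * x₁ , a * x₂ , a * x₃

  dot : Point → Point → Carrier
  dot (a , b , c) (x , y , z) = a * x + b * y + c * z

  cross : Point → Point → Point
  cross (u₁ , u₂ , u₃) (v₁ , v₂ , v₃) = u₂ * v₃ - u₃ * v₂ , u₃ * v₁ - u₁ * v₃ , u₁ * v₂ - u₂ * v₁

  det : Point → Point → Point → Carrier
  det u v w = dot (cross u v) w

module FieldProperties (K : Field) where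

  open Field K public

  commutativeRing : CommutativeRing 0ℓ 0ℓ
  commutativeRing = record { isCommutativeRing = isCommutativeRing }

  open CommutativeRing commutativeRing public
    using ( _-_; +-assoc; +-comm; +-identityˡ; +-identityʳ; -‿inverseˡ; -‿inverseʳ
          ; *-assoc; *-comm; *-identityˡ; *-identityʳ; distribˡ; distribʳ; zeroˡ; zeroʳ
          ; rawRing; ring; +-abelianGroup; *-commutativeMonoid)
  open RingProperties ring public using (-‿involutive; -0#≈0#; x+x≈x⇒x≈0; x[y-z]≈xy-xz)
  open AbelianGroupProperties +-abelianGroup public using (inverseʳ-unique)
    renaming (x∙y⁻¹≈ε⇒x≈y to x-y≡0⇒x≡y; ∙-cancelˡ to +-cancelˡ)
  open import Algebra.Definitions.RawSemiring (RawRing.rawSemiring rawRing) public using (_^_)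
  open IntegerCast commutativeRing public using (solve; _:=_; _:+_; _:*_; _:-_; con; polynomialRawRing)
  open ≡.≡-Reasoning

  1≢0 : 1# ≢ 0#
  1≢0 = 0≢1 ∘ ≡.sym

  inv : (x : Carrier) → x ≢ 0# → Carrier
  inv x x≢0 = proj₁ (inverse x x≢0)

  *-inverseʳ : ∀ x (x≢0 : x ≢ 0#) → x * inv x x≢0 ≡ 1#
  *-inverseʳ x x≢0 = proj₂ (inverse x x≢0)

  *-inverseˡ : ∀ x (x≢0 : x ≢ 0#) → inv x x≢0 * x ≡ 1#
  *-inverseˡ x x≢0 = ≡.trans (*-comm _ x) (*-inverseʳ x x≢0)

  *-cancelˡ : ∀ {c a b} → c ≢ 0# → c * a ≡ c * b → a ≡ b
  *-cancelˡ {c} {a} {b} c≢0 ca≡cb = begin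
    a                    ≡⟨ *-identityˡ a ⟨
    1# * a               ≡⟨ ≡.cong (_* a) (*-inverseˡ c c≢0) ⟨
    (inv c c≢0 * c) * a  ≡⟨ *-assoc _ c a ⟩
    inv c c≢0 * (c * a)  ≡⟨ ≡.cong (inv c c≢0 *_) ca≡cb ⟩
    inv c c≢0 * (c * b)  ≡⟨ *-assoc _ c b ⟨
    (inv c c≢0 * c) * b  ≡⟨ ≡.cong (_* b) (*-inverseˡ c c≢0) ⟩
    1# * b               ≡⟨ *-identityˡ b ⟩
    b                    ∎

  *-cancelʳ : ∀ {c a b} → c ≢ 0# → a * c ≡ b * c → a ≡ b
  *-cancelʳ {c} {a} {b} c≢0 ac≡bc = *-cancelˡ c≢0 (≡.trans (*-comm c a) (≡.trans ac≡bc (*-comm b c)))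

  *-nonzero : ∀ {a b} → a ≢ 0# → b ≢ 0# → a * b ≢ 0#
  *-nonzero {a} a≢0 b≢0 ab≡0 = b≢0 (*-cancelˡ a≢0 (≡.trans ab≡0 (≡.sym (zeroʳ a))))

  inv-nonzero : ∀ x (x≢0 : x ≢ 0#) → inv x x≢0 ≢ 0#
  inv-nonzero x x≢0 x⁻¹≡0 = 1≢0 (begin
    1#               ≡⟨ *-inverseʳ x x≢0 ⟨
    x * inv x x≢0    ≡⟨ ≡.cong (x *_) x⁻¹≡0 ⟩
    x * 0#           ≡⟨ zeroʳ x ⟩
    0#               ∎)

  0^n≡0 : ∀ {n} → 1 ℕ.≤ n → 0# ^ n ≡ 0#
  0^n≡0 (ℕ.s≤s _) = zeroˡ _

  x≢x-1 : ∀ x → x ≢ x - 1#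
  x≢x-1 x x≡x-1 = 1≢0 (begin
    1#        ≡⟨ -‿involutive 1# ⟨
    - - 1#    ≡⟨ ≡.cong -_ (+-cancelˡ x 0# (- 1#) (≡.trans (+-identityʳ x) x≡x-1)) ⟨
    - 0#      ≡⟨ -0#≈0# ⟩
    0#        ∎)

  solve-linear : ∀ {a x y b} (a≢0 : a ≢ 0#) → a * y ≡ x * b → y ≡ (b * inv a a≢0) * x
  solve-linear {a} {x} {y} {b} a≢0 ay≡xb = *-cancelˡ a≢0 (begin
    a * y                                 ≡⟨ ay≡xb ⟩
    x * b                                 ≡⟨ *-identityˡ _ ⟨
    1# * (x * b)                          ≡⟨ ≡.cong (_* (x * b)) (*-inverseʳ a a≢0) ⟨
    (a * inv a a≢0) * (x * b)
      ≡⟨ solve 4 (λ a a⁻¹ x b → (a :* a⁻¹) :* (x :* b) := a :* ((b :* a⁻¹) :* x)) ≡.refl a (inv a a≢0) x b ⟩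
    a * ((b * inv a a≢0) * x)             ∎)

  cross-multiply : ∀ {a b a' b'} (a≢0 : a ≢ 0#) (a'≢0 : a' ≢ 0#) →
                   b * inv a a≢0 ≡ b' * inv a' a'≢0 → a * b' ≡ a' * b
  cross-multiply {a} {b} {a'} {b'} a≢0 a'≢0 b/a≡b'/a' = begin
    a * b'                          ≡⟨ *-identityʳ _ ⟨
    (a * b') * 1#                   ≡⟨ ≡.cong ((a * b') *_) (*-inverseˡ a' a'≢0) ⟨
    (a * b') * (a'⁻¹ * a')          ≡⟨ solve 4 (λ a b' i a' → (a :* b') :* (i :* a') := (a :* a') :* (b' :* i)) ≡.refl a b' a'⁻¹ a' ⟩
    (a * a') * (b' * a'⁻¹)          ≡⟨ ≡.cong ((a * a') *_) b/a≡b'/a' ⟨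
    (a * a') * (b * a⁻¹)            ≡⟨ solve 4 (λ a a' b i → (a :* a') :* (b :* i) := (a' :* b) :* (i :* a)) ≡.refl a a' b a⁻¹ ⟩
    (a' * b) * (a⁻¹ * a)            ≡⟨ ≡.cong ((a' * b) *_) (*-inverseˡ a a≢0) ⟩
    (a' * b) * 1#                   ≡⟨ *-identityʳ _ ⟩
    a' * b                          ∎
    where
    a⁻¹ a'⁻¹ : Carrier
    a⁻¹ = inv a a≢0
    a'⁻¹ = inv a' a'≢0

  zero-product : DecidableEquality Carrier → ∀ {a b} → a * b ≡ 0# → a ≡ 0# ⊎ b ≡ 0#
  zero-product _≟_ {a} ab≡0 with a ≟ 0#
  ... | yes a≡0 = inj₁ a≡0
  ... | no  a≢0 = inj₂ (*-cancelˡ a≢0 (≡.trans ab≡0 (≡.sym (zeroʳ a))))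

∷-injective : ∀ {A : Set} {n} {x : A} {f : Vector A n} →
              (∀ i → x ≢ f i) → Injective _≡_ _≡_ f → Injective _≡_ _≡_ (x ∷ f)
∷-injective x∉f f-inj {zero}  {zero}  _   = ≡.refl
∷-injective x∉f f-inj {zero}  {suc j} eq  = ⊥-elim (x∉f j eq)
∷-injective x∉f f-inj {suc i} {zero}  eq  = ⊥-elim (x∉f i (≡.sym eq))
∷-injective x∉f f-inj {suc i} {suc j} eq  = ≡.cong suc (f-inj eq)

module FiniteField (K : Field) {N : ℕ} (card : Field.Carrier K ↔ Fin N) where

  open FieldProperties K
  open Inverse card using () renaming (to to index; from to element)
  open CommutativeMonoidSum *-commutativeMonoid using (∑-distrib-+; ∑-permute; sum-remove; sum-cong-≗; sum-replicate; sum-replicate-zero)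
    renaming (sum to product)
  open ≡.≡-Reasoning

  _≟_ : DecidableEquality Carrier
  _≟_ = via-injection (↔⇒↣ card) Fin._≟_

  no-injection : ∀ {m} → N ℕ.< m → (f : Fin m → Carrier) → ¬ Injective _≡_ _≡_ f
  no-injection N<m f f-inj = ℕ.<⇒≱ N<m (Fin.injective⇒≤ (f-inj ∘ Injection.injective (↔⇒↣ card)))

  size≥2 : 2 ℕ.≤ N
  size≥2 = ℕ.≮⇒≥ λ N<2 → no-injection N<2 bit bit-injective
    where
    bit : Fin 2 → Carrier
    bit zero       = 0#
    bit (suc zero) = 1#
    bit-injective : Injective _≡_ _≡_ bit
    bit-injective {zero}     {zero}     _    = ≡.refl
    bit-injective {zero}     {suc zero} 0≡1  = ⊥-elim (0≢1 0≡1)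
    bit-injective {suc zero} {zero}     1≡0  = ⊥-elim (1≢0 1≡0)
    bit-injective {suc zero} {suc zero} _    = ≡.refl

  private
    nonzeroPart : Carrier → Carrier
    nonzeroPart x with x ≟ 0#
    ... | yes _ = 1#
    ... | no  _ = x

    nonzeroPart≢0 : ∀ x → nonzeroPart x ≢ 0#
    nonzeroPart≢0 x with x ≟ 0#
    ... | yes _   = 1≢0
    ... | no  x≢0 = x≢0

    product-single : ∀ {n} (f : Fin n → Carrier) i → (∀ j → j ≢ i → f j ≡ 1#) → product f ≡ f i
    product-single {suc n} f i f≡1 = begin
      product f                         ≡⟨ sum-remove {i = i} f ⟩
      f i * product (removeAt f i)      ≡⟨ ≡.cong (f i *_) (sum-cong-≗ λ j → f≡1 _ (Fin.punchInᵢ≢i i j)) ⟩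
      f i * product (replicate n 1#)    ≡⟨ ≡.cong (f i *_) (sum-replicate-zero n) ⟩
      f i * 1#                          ≡⟨ *-identityʳ (f i) ⟩
      f i                               ∎

    product-nonzero : ∀ {n} (f : Fin n → Carrier) → (∀ i → f i ≢ 0#) → product f ≢ 0#
    product-nonzero {zero}  f f≢0 = 1≢0
    product-nonzero {suc n} f f≢0 = *-nonzero (f≢0 zero) (product-nonzero (f ∘ suc) (f≢0 ∘ suc))

  -- x ↦ a x permutes K, so H = ∏ₓ nonzeroPart x is also ∏ₓ nonzeroPart (a x); factor by factor
  -- the latter is a times the former except at x = 0, whence a ^ N * H ≡ a * H.
  module _ {a : Carrier} (a≢0 : a ≢ 0#) where
    private
      atZero : Carrier → Carrier
      atZero x with x ≟ 0#
      ... | yes _ = a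
      ... | no  _ = 1#

      scaling : Permutation N N
      scaling = mk↔ₛ′ (λ i → index (a * element i)) (λ i → index (inv a a≢0 * element i))
                      (λ i → rescale (*-inverseʳ a a≢0) i) (λ i → rescale (*-inverseˡ a a≢0) i)
        where
        rescale : ∀ {b c} → b * c ≡ 1# → ∀ i → index (b * element (index (c * element i))) ≡ i
        rescale {b} {c} bc≡1 i = begin
          index (b * element (index (c * element i)))  ≡⟨ ≡.cong (λ y → index (b * y)) (Inverse.strictlyInverseʳ card _) ⟩
          index (b * (c * element i))                  ≡⟨ ≡.cong index (≡.sym (*-assoc b c _)) ⟩
          index ((b * c) * element i)                  ≡⟨ ≡.cong (λ y → index (y * element i)) bc≡1 ⟩
          index (1# * element i)                       ≡⟨ ≡.cong index (*-identityˡ _) ⟩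
          index (element i)                            ≡⟨ Inverse.strictlyInverseˡ card i ⟩
          i                                            ∎

      nonzeroPart-scaling : ∀ x → nonzeroPart (a * x) * atZero x ≡ a * nonzeroPart x
      nonzeroPart-scaling x with x ≟ 0# | (a * x) ≟ 0#
      ... | yes _   | yes _    = ≡.trans (*-identityˡ a) (≡.sym (*-identityʳ a))
      ... | yes x≡0 | no  ax≢0 = ⊥-elim (ax≢0 (≡.trans (≡.cong (a *_) x≡0) (zeroʳ a)))
      ... | no  x≢0 | yes ax≡0 = ⊥-elim (*-nonzero a≢0 x≢0 ax≡0)
      ... | no  _   | no  _    = *-identityʳ (a * x)

      product-atZero : product (atZero ∘ element) ≡ a
      product-atZero = begin
        product (atZero ∘ element)      ≡⟨ product-single (atZero ∘ element) (index 0#) elsewhere ⟩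
        atZero (element (index 0#))     ≡⟨ ≡.cong atZero (Inverse.strictlyInverseʳ card 0#) ⟩
        atZero 0#                       ≡⟨ at0 ⟩
        a                               ∎
        where
        at0 : atZero 0# ≡ a
        at0 with 0# ≟ 0#
        ... | yes _   = ≡.refl
        ... | no  0≢0 = ⊥-elim (0≢0 ≡.refl)
        elsewhere : ∀ j → j ≢ index 0# → atZero (element j) ≡ 1#
        elsewhere j j≢0 with element j ≟ 0#
        ... | no  _   = ≡.refl
        ... | yes x≡0 = ⊥-elim (j≢0 (begin
          j                  ≡⟨ Inverse.strictlyInverseˡ card j ⟨
          index (element j)  ≡⟨ ≡.cong index x≡0 ⟩
          index 0#           ∎))

    fermat-nonzero : a ^ N ≡ a
    fermat-nonzero = *-cancelʳ (product-nonzero (nonzeroPart ∘ element) (nonzeroPart≢0 ∘ element)) (begin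
      a ^ N * H                                                 ≡⟨ ≡.cong (_* H) (sum-replicate N) ⟨
      product (replicate N a) * H                               ≡⟨ ∑-distrib-+ (replicate N a) (nonzeroPart ∘ element) ⟨
      product (λ i → a * nonzeroPart (element i))               ≡⟨ sum-cong-≗ (λ i → nonzeroPart-scaling (element i)) ⟨
      product (λ i → nonzeroPart (a * element i) * atZero (element i))
        ≡⟨ ∑-distrib-+ (λ i → nonzeroPart (a * element i)) (atZero ∘ element) ⟩
      product (λ i → nonzeroPart (a * element i)) * product (atZero ∘ element)
        ≡⟨ ≡.cong₂ _*_ permuted product-atZero ⟩
      H * a                                                     ≡⟨ *-comm H a ⟩
      a * H                                                     ∎)
      where
      H : Carrier
      H = product (nonzeroPart ∘ element)
      permuted : product (λ i → nonzeroPart (a * element i)) ≡ H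
      permuted = begin
        product (λ i → nonzeroPart (a * element i))
          ≡⟨ sum-cong-≗ (λ i → ≡.cong nonzeroPart (Inverse.strictlyInverseʳ card (a * element i))) ⟨
        product (λ i → nonzeroPart (element (index (a * element i))))
          ≡⟨ ∑-permute (nonzeroPart ∘ element) scaling ⟨
        H ∎

  fermat : ∀ a → a ^ N ≡ a
  fermat a with a ≟ 0#
  ... | no  a≢0 = fermat-nonzero a≢0
  ... | yes ≡.refl = 0^n≡0 (ℕ.≤-trans (ℕ.s≤s ℕ.z≤n) size≥2)

  -- If M failed at y it would fail at y - 1 as well, and 0, y, y - 1 and the r i
  -- would be N + 1 distinct elements.
  +1-closed-saturates : (M : Carrier → Set) → M 0# → (∀ {y} → M y → M (y + 1#)) →
                        ∀ {m} (r : Fin m → Carrier) → Injective _≡_ _≡_ r → (∀ i → r i ≢ 0#) → (∀ i → M (r i)) →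
                        N ℕ.≤ 2 ℕ.+ m → ∀ y → ¬ ¬ M y
  +1-closed-saturates M M0 M-suc r r-injective r≢0 Mr N≤2+m y ¬My =
    no-injection (ℕ.s≤s N≤2+m) (0# ∷ y ∷ (y - 1#) ∷ r)
      (∷-injective 0∉ (∷-injective y∉ (∷-injective y-1∉ r-injective)))
    where
    separated : ∀ {a b} → M a → ¬ M b → a ≢ b
    separated Ma ¬Mb a≡b = ¬Mb (≡.subst M a≡b Ma)
    ¬M[y-1] : ¬ M (y - 1#)
    ¬M[y-1] M[y-1] = ¬My (≡.subst M y-1+1≡y (M-suc M[y-1]))
      where
      y-1+1≡y : y - 1# + 1# ≡ y
      y-1+1≡y = ≡.trans (+-assoc y (- 1#) 1#) (≡.trans (≡.cong (y +_) (-‿inverseˡ 1#)) (+-identityʳ y))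
    0∉ : ∀ i → 0# ≢ (y ∷ (y - 1#) ∷ r) i
    0∉ zero          = separated M0 ¬My
    0∉ (suc zero)    = separated M0 ¬M[y-1]
    0∉ (suc (suc i)) = r≢0 i ∘ ≡.sym
    y∉ : ∀ i → y ≢ ((y - 1#) ∷ r) i
    y∉ zero    = x≢x-1 y
    y∉ (suc i) = separated (Mr i) ¬My ∘ ≡.sym
    y-1∉ : ∀ i → y - 1# ≢ r i
    y-1∉ i = separated (Mr i) ¬M[y-1] ∘ ≡.sym

module MonicPolynomials (K : Field) (_≟_ : DecidableEquality (Field.Carrier K)) where

  open FieldProperties K
  open ≡.≡-Reasoning

  -- Monic d f: f is the polynomial function of a monic polynomial of degree d, in Horner form.
  Monic : ℕ → (Carrier → Carrier) → Set
  Monic zero    f = ∀ x → f x ≡ 1#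
  Monic (suc d) f = ∃[ g ] ∃[ c ] (Monic d g × ∀ x → f x ≡ x * g x + c)

  factor-theorem : ∀ d {f} → Monic (suc d) f → ∀ r → ∃[ g ] (Monic d g × ∀ x → f x ≡ (x - r) * g x + f r)
  factor-theorem zero {f} (g , c , g≡1 , f≡) r = g , g≡1 , λ x → begin
    f x                          ≡⟨ f≡ x ⟩
    x * g x + c                  ≡⟨ ≡.cong (λ y → x * y + c) (g≡1 x) ⟩
    x * 1# + c                   ≡⟨ solve 4 (λ x r c o → x :* o :+ c := (x :- r) :* o :+ (r :* o :+ c)) ≡.refl x r c 1# ⟩
    (x - r) * 1# + (r * 1# + c)  ≡⟨ ≡.cong₂ (λ y z → (x - r) * y + (r * z + c)) (g≡1 x) (g≡1 r) ⟨
    (x - r) * g x + (r * g r + c) ≡⟨ ≡.cong ((x - r) * g x +_) (f≡ r) ⟨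
    (x - r) * g x + f r          ∎
  factor-theorem (suc d) {f} (g , c , g-monic , f≡) r with factor-theorem d g-monic r
  ... | h , h-monic , g≡ = (λ x → x * h x + g r) , (h , g r , h-monic , λ _ → ≡.refl) , λ x → begin
    f x                                       ≡⟨ f≡ x ⟩
    x * g x + c                               ≡⟨ ≡.cong (λ y → x * y + c) (g≡ x) ⟩
    x * ((x - r) * h x + g r) + c
      ≡⟨ solve 5 (λ x r h g c → x :* ((x :- r) :* h :+ g) :+ c := (x :- r) :* (x :* h :+ g) :+ (r :* g :+ c))
                 ≡.refl x r (h x) (g r) c ⟩
    (x - r) * (x * h x + g r) + (r * g r + c) ≡⟨ ≡.cong ((x - r) * (x * h x + g r) +_) (f≡ r) ⟨
    (x - r) * (x * h x + g r) + f r           ∎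

  root-bound : ∀ d {f} → Monic d f → (rs : Fin (suc d) → Carrier) → Injective _≡_ _≡_ rs → ¬ (∀ i → f (rs i) ≡ 0#)
  root-bound zero    f-monic rs _       roots = 1≢0 (≡.trans (≡.sym (f-monic (rs zero))) (roots zero))
  root-bound (suc d) {f} f-monic rs rs-inj roots with factor-theorem d f-monic (rs zero)
  ... | g , g-monic , f≡ = root-bound d g-monic (rs ∘ suc) (Fin.suc-injective ∘ rs-inj) g-roots
    where
    g-roots : ∀ i → g (rs (suc i)) ≡ 0#
    g-roots i with zero-product _≟_ (begin
      (rs (suc i) - rs zero) * g (rs (suc i))        ≡⟨ +-identityʳ _ ⟨
      (rs (suc i) - rs zero) * g (rs (suc i)) + 0#   ≡⟨ ≡.cong (_ +_) (roots zero) ⟨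
      (rs (suc i) - rs zero) * g (rs (suc i)) + f (rs zero) ≡⟨ f≡ (rs (suc i)) ⟨
      f (rs (suc i))                                 ≡⟨ roots (suc i) ⟩
      0#                                             ∎)
    ... | inj₁ rᵢ-r₀≡0 = ⊥-elim (Fin.0≢1+n (rs-inj (≡.sym (x-y≡0⇒x≡y _ _ rᵢ-r₀≡0))))
    ... | inj₂ g≡0     = g≡0

  X^n-monic : ∀ n → Monic n (_^ n)
  X^n-monic zero    _ = ≡.refl
  X^n-monic (suc n)   = (_^ n) , 0# , X^n-monic n , λ x → ≡.sym (+-identityʳ _)

  X^n-X-monic : ∀ n → Monic (suc (suc n)) (λ x → x ^ suc (suc n) - x)
  X^n-X-monic n = (λ x → x ^ suc n - 1#) , 0# , ((_^ n) , - 1# , X^n-monic n , λ _ → ≡.refl) , λ x → begin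
    x * x ^ suc n - x           ≡⟨ ≡.cong (λ y → x * x ^ suc n - y) (*-identityʳ x) ⟨
    x * x ^ suc n - x * 1#      ≡⟨ x[y-z]≈xy-xz x (x ^ suc n) 1# ⟨
    x * (x ^ suc n - 1#)        ≡⟨ +-identityʳ _ ⟨
    x * (x ^ suc n - 1#) + 0#   ∎

module Plane (F E : Field) (ι : Field.Carrier F → Field.Carrier E) (_≟_ : DecidableEquality (Field.Carrier E)) where

  open Geometry F E ι public
  open FieldProperties E public
  open CoordinateFormulas rawRing public using (cross; det)
  private
    module P {n} = CoordinateFormulas (polynomialRawRing n)
  open P using (_⊞_; _⊡_)
  open ≡.≡-Reasoning

  •-assoc : ∀ a b x → a • (b • x) ≡ (a * b) • x
  •-assoc a b (x , y , z) = ≡.sym (≡.cong₂ _,_ (*-assoc a b x) (≡.cong₂ _,_ (*-assoc a b y) (*-assoc a b z)))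

  •-identityˡ : ∀ x → 1# • x ≡ x
  •-identityˡ (x , y , z) = ≡.cong₂ _,_ (*-identityˡ x) (≡.cong₂ _,_ (*-identityˡ y) (*-identityˡ z))

  •-zeroˡ : ∀ x → 0# • x ≡ 0V
  •-zeroˡ (x , y , z) = ≡.cong₂ _,_ (zeroˡ x) (≡.cong₂ _,_ (zeroˡ y) (zeroˡ z))

  •-distribˡ : ∀ a x y → a • (x ⊕ y) ≡ (a • x) ⊕ (a • y)
  •-distribˡ a (x , y , z) (x' , y' , z') = ≡.cong₂ _,_ (distribˡ a x x') (≡.cong₂ _,_ (distribˡ a y y') (distribˡ a z z'))

  •-distribʳ : ∀ a b x → (a + b) • x ≡ (a • x) ⊕ (b • x)
  •-distribʳ a b (x , y , z) = ≡.cong₂ _,_ (distribʳ x a b) (≡.cong₂ _,_ (distribʳ y a b) (distribʳ z a b))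

  ⊕-identityʳ : ∀ x → x ⊕ 0V ≡ x
  ⊕-identityʳ (x , y , z) = ≡.cong₂ _,_ (+-identityʳ x) (≡.cong₂ _,_ (+-identityʳ y) (+-identityʳ z))

  x⊕x≡x⇒x≡0 : ∀ {x} → x ⊕ x ≡ x → x ≡ 0V
  x⊕x≡x⇒x≡0 {x , y , z} eq = ≡.cong₂ _,_ (x+x≈x⇒x≈0 x (≡.cong proj₁ eq))
    (≡.cong₂ _,_ (x+x≈x⇒x≈0 y (≡.cong (proj₁ ∘ proj₂) eq)) (x+x≈x⇒x≈0 z (≡.cong (proj₂ ∘ proj₂) eq)))

  •-cancelʳ : ∀ {a b x} → x ≢ 0V → a • x ≡ b • x → a ≡ b
  •-cancelʳ {x = x , y , z} x≢0 eq with x ≟ 0# | y ≟ 0# | z ≟ 0#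
  ... | no x≢0' | _       | _       = *-cancelʳ x≢0' (≡.cong proj₁ eq)
  ... | yes _   | no y≢0  | _       = *-cancelʳ y≢0 (≡.cong (proj₁ ∘ proj₂) eq)
  ... | yes _   | yes _   | no z≢0  = *-cancelʳ z≢0 (≡.cong (proj₂ ∘ proj₂) eq)
  ... | yes x≡0 | yes y≡0 | yes z≡0 = ⊥-elim (x≢0 (≡.cong₂ _,_ x≡0 (≡.cong₂ _,_ y≡0 z≡0)))

  •-nonzero : ∀ {a x} → a ≢ 0# → x ≢ 0V → a • x ≢ 0V
  •-nonzero {a} {x} a≢0 x≢0 ax≡0 = a≢0 (•-cancelʳ x≢0 (≡.trans ax≡0 (≡.sym (•-zeroˡ x))))

  combination : Carrier → Carrier → Carrier → V → V → V → V
  combination a b c u v w = ((a • u) ⊕ (b • v)) ⊕ (c • w)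

  •-combination : ∀ l a b c u v w → l • combination a b c u v w ≡ combination (l * a) (l * b) (l * c) u v w
  •-combination l a b c u v w = begin
    l • (((a • u) ⊕ (b • v)) ⊕ (c • w))              ≡⟨ •-distribˡ l _ _ ⟩
    (l • ((a • u) ⊕ (b • v))) ⊕ (l • (c • w))         ≡⟨ ≡.cong₂ _⊕_ (•-distribˡ l _ _) (•-assoc l c w) ⟩
    ((l • (a • u)) ⊕ (l • (b • v))) ⊕ ((l * c) • w)   ≡⟨ ≡.cong₂ (λ y z → (y ⊕ z) ⊕ ((l * c) • w)) (•-assoc l a u) (•-assoc l b v) ⟩
    combination (l * a) (l * b) (l * c) u v w         ∎

  det-zeroˡ : ∀ v w → det 0V v w ≡ 0#
  det-zeroˡ (v₁ , v₂ , v₃) (w₁ , w₂ , w₃) =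
    solve 6 (λ v₁ v₂ v₃ w₁ w₂ w₃ → let o = con (ℤ.+ 0) in P.det (o , o , o) (v₁ , v₂ , v₃) (w₁ , w₂ , w₃) := o)
      ≡.refl v₁ v₂ v₃ w₁ w₂ w₃

  det-alternating₁₃ : ∀ u v → det u v u ≡ 0#
  det-alternating₁₃ (u₁ , u₂ , u₃) (v₁ , v₂ , v₃) =
    solve 6 (λ u₁ u₂ u₃ v₁ v₂ v₃ → P.det (u₁ , u₂ , u₃) (v₁ , v₂ , v₃) (u₁ , u₂ , u₃) := con (ℤ.+ 0))
      ≡.refl u₁ u₂ u₃ v₁ v₂ v₃

  det-alternating₂₃ : ∀ u v → det u v v ≡ 0#
  det-alternating₂₃ (u₁ , u₂ , u₃) (v₁ , v₂ , v₃) =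
    solve 6 (λ u₁ u₂ u₃ v₁ v₂ v₃ → P.det (u₁ , u₂ , u₃) (v₁ , v₂ , v₃) (v₁ , v₂ , v₃) := con (ℤ.+ 0))
      ≡.refl u₁ u₂ u₃ v₁ v₂ v₃

  det-scale : ∀ a b c u v w → det (a • u) (b • v) (c • w) ≡ a * b * c * det u v w
  det-scale a b c (u₁ , u₂ , u₃) (v₁ , v₂ , v₃) (w₁ , w₂ , w₃) =
    solve 12 (λ a b c u₁ u₂ u₃ v₁ v₂ v₃ w₁ w₂ w₃ →
      let u = u₁ , u₂ , u₃ ; v = v₁ , v₂ , v₃ ; w = w₁ , w₂ , w₃ in
      P.det (a ⊡ u) (b ⊡ v) (c ⊡ w) := a :* b :* c :* P.det u v w)
      ≡.refl a b c u₁ u₂ u₃ v₁ v₂ v₃ w₁ w₂ w₃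

  det-combination₁ : ∀ a b c u v w → det (combination a b c u v w) v w ≡ a * det u v w
  det-combination₁ a b c (u₁ , u₂ , u₃) (v₁ , v₂ , v₃) (w₁ , w₂ , w₃) =
    solve 12 (λ a b c u₁ u₂ u₃ v₁ v₂ v₃ w₁ w₂ w₃ →
      let u = u₁ , u₂ , u₃ ; v = v₁ , v₂ , v₃ ; w = w₁ , w₂ , w₃ in
      P.det (a ⊡ u ⊞ b ⊡ v ⊞ c ⊡ w) v w := a :* P.det u v w)
      ≡.refl a b c u₁ u₂ u₃ v₁ v₂ v₃ w₁ w₂ w₃

  det-combination₂ : ∀ a b c u v w → det u (combination a b c u v w) w ≡ b * det u v w
  det-combination₂ a b c (u₁ , u₂ , u₃) (v₁ , v₂ , v₃) (w₁ , w₂ , w₃) =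
    solve 12 (λ a b c u₁ u₂ u₃ v₁ v₂ v₃ w₁ w₂ w₃ →
      let u = u₁ , u₂ , u₃ ; v = v₁ , v₂ , v₃ ; w = w₁ , w₂ , w₃ in
      P.det u (a ⊡ u ⊞ b ⊡ v ⊞ c ⊡ w) w := b :* P.det u v w)
      ≡.refl a b c u₁ u₂ u₃ v₁ v₂ v₃ w₁ w₂ w₃

  det-combination₃ : ∀ a b c u v w → det u v (combination a b c u v w) ≡ c * det u v w
  det-combination₃ a b c (u₁ , u₂ , u₃) (v₁ , v₂ , v₃) (w₁ , w₂ , w₃) =
    solve 12 (λ a b c u₁ u₂ u₃ v₁ v₂ v₃ w₁ w₂ w₃ →
      let u = u₁ , u₂ , u₃ ; v = v₁ , v₂ , v₃ ; w = w₁ , w₂ , w₃ in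
      P.det u v (a ⊡ u ⊞ b ⊡ v ⊞ c ⊡ w) := c :* P.det u v w)
      ≡.refl a b c u₁ u₂ u₃ v₁ v₂ v₃ w₁ w₂ w₃

  det-two-combinations : ∀ a b c a' b' c' u v w →
    det w (combination a b c u v w) (combination a' b' c' u v w) ≡ (a * b' - a' * b) * det w u v
  det-two-combinations a b c a' b' c' (u₁ , u₂ , u₃) (v₁ , v₂ , v₃) (w₁ , w₂ , w₃) =
    solve 15 (λ a b c a' b' c' u₁ u₂ u₃ v₁ v₂ v₃ w₁ w₂ w₃ →
      let u = u₁ , u₂ , u₃ ; v = v₁ , v₂ , v₃ ; w = w₁ , w₂ , w₃ in
      P.det w (a ⊡ u ⊞ b ⊡ v ⊞ c ⊡ w) (a' ⊡ u ⊞ b' ⊡ v ⊞ c' ⊡ w) := (a :* b' :- a' :* b) :* P.det w u v)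
      ≡.refl a b c a' b' c' u₁ u₂ u₃ v₁ v₂ v₃ w₁ w₂ w₃

  cramer : ∀ u v w x → det u v w • x ≡ combination (det x v w) (det u x w) (det u v x) u v w
  cramer (u₁ , u₂ , u₃) (v₁ , v₂ , v₃) (w₁ , w₂ , w₃) (x₁ , x₂ , x₃) =
    ≡.cong₂ _,_
      (solve 12 (λ u₁ u₂ u₃ v₁ v₂ v₃ w₁ w₂ w₃ x₁ x₂ x₃ →
        let u = u₁ , u₂ , u₃ ; v = v₁ , v₂ , v₃ ; w = w₁ , w₂ , w₃ ; x = x₁ , x₂ , x₃ in
        proj₁ (P.det u v w ⊡ x) := proj₁ (P.det x v w ⊡ u ⊞ P.det u x w ⊡ v ⊞ P.det u v x ⊡ w))
        ≡.refl u₁ u₂ u₃ v₁ v₂ v₃ w₁ w₂ w₃ x₁ x₂ x₃)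
    (≡.cong₂ _,_
      (solve 12 (λ u₁ u₂ u₃ v₁ v₂ v₃ w₁ w₂ w₃ x₁ x₂ x₃ →
        let u = u₁ , u₂ , u₃ ; v = v₁ , v₂ , v₃ ; w = w₁ , w₂ , w₃ ; x = x₁ , x₂ , x₃ in
        proj₁ (proj₂ (P.det u v w ⊡ x)) := proj₁ (proj₂ (P.det x v w ⊡ u ⊞ P.det u x w ⊡ v ⊞ P.det u v x ⊡ w)))
        ≡.refl u₁ u₂ u₃ v₁ v₂ v₃ w₁ w₂ w₃ x₁ x₂ x₃)
      (solve 12 (λ u₁ u₂ u₃ v₁ v₂ v₃ w₁ w₂ w₃ x₁ x₂ x₃ →
        let u = u₁ , u₂ , u₃ ; v = v₁ , v₂ , v₃ ; w = w₁ , w₂ , w₃ ; x = x₁ , x₂ , x₃ in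
        proj₂ (proj₂ (P.det u v w ⊡ x)) := proj₂ (proj₂ (P.det x v w ⊡ u ⊞ P.det u x w ⊡ v ⊞ P.det u v x ⊡ w)))
        ≡.refl u₁ u₂ u₃ v₁ v₂ v₃ w₁ w₂ w₃ x₁ x₂ x₃))

  module Basis {u v w : V} (D≢0 : det u v w ≢ 0#) where

    private
      D⁻¹ : Carrier
      D⁻¹ = inv (det u v w) D≢0

    coordinate₁ coordinate₂ coordinate₃ : V → Carrier
    coordinate₁ x = D⁻¹ * det x v w
    coordinate₂ x = D⁻¹ * det u x w
    coordinate₃ x = D⁻¹ * det u v x

    expansion : ∀ x → x ≡ combination (coordinate₁ x) (coordinate₂ x) (coordinate₃ x) u v w
    expansion x = begin
      x                                                        ≡⟨ •-identityˡ x ⟨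
      1# • x                                                   ≡⟨ ≡.cong (_• x) (*-inverseˡ _ D≢0) ⟨
      (D⁻¹ * det u v w) • x                                    ≡⟨ •-assoc D⁻¹ _ x ⟨
      D⁻¹ • (det u v w • x)                                    ≡⟨ ≡.cong (D⁻¹ •_) (cramer u v w x) ⟩
      D⁻¹ • combination (det x v w) (det u x w) (det u v x) u v w ≡⟨ •-combination D⁻¹ _ _ _ u v w ⟩
      combination (coordinate₁ x) (coordinate₂ x) (coordinate₃ x) u v w ∎

    combination-injective : ∀ a b c a' b' c' → combination a b c u v w ≡ combination a' b' c' u v w →
                            a ≡ a' × b ≡ b' × c ≡ c'
    combination-injective a b c a' b' c' eq =
        recover (λ x → det x v w) (det-combination₁ a b c u v w) (det-combination₁ a' b' c' u v w)
      , recover (λ x → det u x w) (det-combination₂ a b c u v w) (det-combination₂ a' b' c' u v w)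
      , recover (λ x → det u v x) (det-combination₃ a b c u v w) (det-combination₃ a' b' c' u v w)
      where
      recover : ∀ {s s'} (f : V → Carrier) → f (combination a b c u v w) ≡ s * det u v w →
                f (combination a' b' c' u v w) ≡ s' * det u v w → s ≡ s'
      recover f fx≡sD fx'≡s'D = *-cancelʳ D≢0 (≡.trans (≡.sym fx≡sD) (≡.trans (≡.cong f eq) fx'≡s'D))

  cross≡0⇒proportional : ∀ {a b} → a ≢ 0V → cross a b ≡ 0V → ∃[ t ] (b ≡ t • a)
  cross≡0⇒proportional {a₁ , a₂ , a₃} {b₁ , b₂ , b₃} a≢0 a×b≡0 with a₁ ≟ 0# | a₂ ≟ 0# | a₃ ≟ 0#
  ... | no a₁≢0 | _       | _       = _ , ≡.cong₂ _,_ (solve-linear a₁≢0 ≡.refl)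
        (≡.cong₂ _,_ (solve-linear a₁≢0 (x-y≡0⇒x≡y _ _ c₃)) (solve-linear a₁≢0 (≡.sym (x-y≡0⇒x≡y _ _ c₂))))
    where c₂ = ≡.cong (proj₁ ∘ proj₂) a×b≡0 ; c₃ = ≡.cong (proj₂ ∘ proj₂) a×b≡0
  ... | yes _   | no a₂≢0 | _       = _ , ≡.cong₂ _,_ (solve-linear a₂≢0 (≡.sym (x-y≡0⇒x≡y _ _ c₃)))
        (≡.cong₂ _,_ (solve-linear a₂≢0 ≡.refl) (solve-linear a₂≢0 (x-y≡0⇒x≡y _ _ c₁)))
    where c₁ = ≡.cong proj₁ a×b≡0 ; c₃ = ≡.cong (proj₂ ∘ proj₂) a×b≡0
  ... | yes _   | yes _   | no a₃≢0 = _ , ≡.cong₂ _,_ (solve-linear a₃≢0 (x-y≡0⇒x≡y _ _ c₂))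
        (≡.cong₂ _,_ (solve-linear a₃≢0 (≡.sym (x-y≡0⇒x≡y _ _ c₁))) (solve-linear a₃≢0 ≡.refl))
    where c₁ = ≡.cong proj₁ a×b≡0 ; c₂ = ≡.cong (proj₁ ∘ proj₂) a×b≡0
  ... | yes a₁≡0 | yes a₂≡0 | yes a₃≡0 = ⊥-elim (a≢0 (≡.cong₂ _,_ a₁≡0 (≡.cong₂ _,_ a₂≡0 a₃≡0)))

  record IsArc {m} (O : Fin m → V) : Set where
    field
      nonzero    : ∀ i → O i ≢ 0V
      distinct   : ∀ i j → i ≢ j → ¬ SamePoint (O i) (O j)
      noThreeCol : ∀ i j k → i ≢ j → i ≢ k → j ≢ k → ¬ Collinear (O i) (O j) (O k)

  Represents : V → V → Set
  Represents p x = fieldReduction p x × x ≢ 0V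

  point-represents : ∀ {m} {O : Fin m → V} → IsArc O → ∀ i → Represents (O i) (O i)
  point-represents arc i = (1# , ≡.sym (•-identityˡ _)) , IsArc.nonzero arc i

  module _ {m} {O : Fin m → V} (arc : IsArc O) where
    open IsArc arc

    arc-det≢0 : ∀ {i j k} → i ≢ j → i ≢ k → j ≢ k → det (O i) (O j) (O k) ≢ 0#
    arc-det≢0 {i} {j} {k} i≢j i≢k j≢k D≡0 with cross (O i) (O j) ≟V 0V
      where
      _≟V_ : DecidableEquality V
      _≟V_ = Product.≡-dec _≟_ (Product.≡-dec _≟_ _≟_)
    ... | yes Oᵢ×Oⱼ≡0 = distinct i j i≢j (cross≡0⇒proportional (nonzero i) Oᵢ×Oⱼ≡0)
    ... | no  Oᵢ×Oⱼ≢0 = noThreeCol i j k i≢j i≢k j≢k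
                         (cross (O i) (O j) , Oᵢ×Oⱼ≢0 , det-alternating₁₃ (O i) (O j) , det-alternating₂₃ (O i) (O j) , D≡0)

    representatives-det≢0 : ∀ {i j k a b c} → i ≢ j → i ≢ k → j ≢ k →
      Represents (O i) a → Represents (O j) b → Represents (O k) c → det a b c ≢ 0#
    representatives-det≢0 i≢j i≢k j≢k ((s , ≡.refl) , a≢0) ((t , ≡.refl) , b≢0) ((r , ≡.refl) , c≢0) D≡0 =
      *-nonzero (*-nonzero (*-nonzero (scalar≢0 a≢0) (scalar≢0 b≢0)) (scalar≢0 c≢0)) (arc-det≢0 i≢j i≢k j≢k)
        (≡.trans (≡.sym (det-scale s t r _ _ _)) D≡0)
      where
      scalar≢0 : ∀ {s x} → s • x ≢ 0V → s ≢ 0#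
      scalar≢0 {x = x} sx≢0 s≡0 = sx≢0 (≡.trans (≡.cong (_• x) s≡0) (•-zeroˡ x))

module Homomorphism (K L : Field) (f : Field.Carrier K → Field.Carrier L)
  (f-+ : ∀ a b → f (Field._+_ K a b) ≡ Field._+_ L (f a) (f b))
  (f-* : ∀ a b → f (Field._*_ K a b) ≡ Field._*_ L (f a) (f b))
  (f-1 : f (Field.1# K) ≡ Field.1# L) where

  private
    module K = FieldProperties K
    module L = FieldProperties L
  open ≡.≡-Reasoning

  f-0 : f K.0# ≡ L.0#
  f-0 = L.x+x≈x⇒x≈0 _ (≡.trans (≡.sym (f-+ K.0# K.0#)) (≡.cong f (K.+-identityˡ K.0#)))

  f-neg : ∀ a → f (K.- a) ≡ L.- f a
  f-neg a = L.inverseʳ-unique (f a) (f (K.- a)) (≡.trans (≡.sym (f-+ a (K.- a))) (≡.trans (≡.cong f (K.-‿inverseʳ a)) f-0))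

  f-^ : ∀ a n → f (a K.^ n) ≡ f a L.^ n
  f-^ a zero    = f-1
  f-^ a (suc n) = ≡.trans (f-* a (a K.^ n)) (≡.cong (f a L.*_) (f-^ a n))

  f-injective : DecidableEquality K.Carrier → Injective _≡_ _≡_ f
  f-injective _≟_ {a} {b} fa≡fb with (a K.- b) ≟ K.0#
  ... | yes a-b≡0 = K.x-y≡0⇒x≡y a b a-b≡0
  ... | no  a-b≢0 = ⊥-elim (L.0≢1 (begin
    L.0#                                     ≡⟨ L.zeroˡ _ ⟨
    L.0# L.* f (K.inv (a K.- b) a-b≢0)       ≡⟨ ≡.cong (L._* _) f[a-b]≡0 ⟨
    f (a K.- b) L.* f (K.inv (a K.- b) a-b≢0) ≡⟨ f-* _ _ ⟨
    f ((a K.- b) K.* K.inv (a K.- b) a-b≢0)  ≡⟨ ≡.cong f (K.*-inverseʳ _ a-b≢0) ⟩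
    f K.1#                                   ≡⟨ f-1 ⟩
    L.1#                                     ∎))
    where
    f[a-b]≡0 : f (a K.- b) ≡ L.0#
    f[a-b]≡0 = begin
      f (a K.- b)        ≡⟨ f-+ a (K.- b) ⟩
      f a L.+ f (K.- b)  ≡⟨ ≡.cong (f a L.+_) (f-neg b) ⟩
      f a L.- f b        ≡⟨ ≡.cong (L._- f b) fa≡fb ⟩
      f b L.- f b        ≡⟨ L.-‿inverseʳ (f b) ⟩
      L.0#               ∎

automorphism-1 : ∀ K {τ} → IsFieldAutomorphism K τ → τ (Field.1# K) ≡ Field.1# K
automorphism-1 K {τ} τ-aut = *-cancelˡ τ1≢0 (begin
  τ 1# * τ 1#   ≡⟨ pres-* 1# 1# ⟨
  τ (1# * 1#)   ≡⟨ ≡.cong τ (*-identityʳ 1#) ⟩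
  τ 1#          ≡⟨ *-identityʳ (τ 1#) ⟨
  τ 1# * 1#     ∎)
  where
  open ≡.≡-Reasoning
  open FieldProperties K
  open IsFieldAutomorphism τ-aut
  τ0≡0 : τ 0# ≡ 0#
  τ0≡0 = x+x≈x⇒x≈0 _ (≡.trans (≡.sym (pres-+ 0# 0#)) (≡.cong τ (+-identityˡ 0#)))
  τ1≢0 : τ 1# ≢ 0#
  τ1≢0 τ1≡0 = 1≢0 (proj₁ bijective (≡.trans τ1≡0 (≡.sym τ0≡0)))

module OvalToPseudoOval (F E : Field) (ι : Field.Carrier F → Field.Carrier E) (ι-hom : IsFieldHom F E ι)
  {k : ℕ} (cardF : Field.Carrier F ↔ Fin (suc (suc k))) (_≟_ : DecidableEquality (Field.Carrier E)) where

  open Plane F E ι _≟_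
  open MonicPolynomials E _≟_
  open IsFieldHom ι-hom
  private
    module F = FieldProperties F
    module ι = Homomorphism F E ι pres-+ pres-* pres-1
    q : ℕ
    q = suc (suc k)
  open Inverse cardF using () renaming (from to element)
  open ≡.≡-Reasoning

  ι-fermat : ∀ a → ι a ^ q ≡ ι a
  ι-fermat a = ≡.trans (≡.sym (ι.f-^ a q)) (≡.cong ι (FiniteField.fermat F cardF a))

  -- ι(F) consists of q roots of X^q - X, so it contains all of them.
  roots-in-image : ∀ y → y ^ q ≡ y → ∃[ a ] ι a ≡ y
  roots-in-image y y^q≡y with Fin.any? (λ i → ι (element i) ≟ y)
  ... | yes (i , ιaᵢ≡y) = element i , ιaᵢ≡y
  ... | no  y∉ι         = ⊥-elim (root-bound q (X^n-X-monic k) (y ∷ ι ∘ element) roots-injective roots)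
    where
    roots-injective : Injective _≡_ _≡_ (y ∷ ι ∘ element)
    roots-injective = ∷-injective (λ i y≡ιaᵢ → y∉ι (i , ≡.sym y≡ιaᵢ))
      (Injection.injective (↔⇒↣ (↔-sym cardF)) ∘ ι.f-injective (FiniteField._≟_ F cardF))
    roots : ∀ i → (y ∷ ι ∘ element) i ^ q - (y ∷ ι ∘ element) i ≡ 0#
    roots zero    = ≡.trans (≡.cong (_- y) y^q≡y) (-‿inverseʳ y)
    roots (suc i) = ≡.trans (≡.cong (_- ι (element i)) (ι-fermat (element i))) (-‿inverseʳ _)

  module Restriction {τ} (τ-aut : IsFieldAutomorphism E τ) where

    open IsFieldAutomorphism τ-aut renaming (bijective to τ-bijective; pres-+ to τ-+; pres-* to τ-*)
    private
      module τ = Homomorphism E E τ τ-+ τ-* (automorphism-1 E τ-aut)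

      τι-root : ∀ a → τ (ι a) ^ q ≡ τ (ι a)
      τι-root a = ≡.trans (≡.sym (τ.f-^ (ι a) q)) (≡.cong τ (ι-fermat a))

    σ : F.Carrier → F.Carrier
    σ a = proj₁ (roots-in-image (τ (ι a)) (τι-root a))

    ι∘σ≡τ∘ι : ∀ a → ι (σ a) ≡ τ (ι a)
    ι∘σ≡τ∘ι a = proj₂ (roots-in-image (τ (ι a)) (τι-root a))

    private
      ι-injective : Injective _≡_ _≡_ ι
      ι-injective = ι.f-injective (FiniteField._≟_ F cardF)

      σ-surjective : ∀ b → ∃[ a ] σ a ≡ b
      σ-surjective b with proj₂ τ-bijective (ι b)
      ... | y , τy≡ιb with roots-in-image y (proj₁ τ-bijective (begin
        τ (y ^ q)     ≡⟨ τ.f-^ y q ⟩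
        τ y ^ q       ≡⟨ ≡.cong (_^ q) (τy≡ιb ≡.refl) ⟩
        ι b ^ q       ≡⟨ ι-fermat b ⟩
        ι b           ≡⟨ τy≡ιb ≡.refl ⟨
        τ y           ∎))
      ... | a , ιa≡y = a , ι-injective (begin
        ι (σ a)  ≡⟨ ι∘σ≡τ∘ι a ⟩
        τ (ι a)  ≡⟨ ≡.cong τ ιa≡y ⟩
        τ y      ≡⟨ τy≡ιb ≡.refl ⟩
        ι b      ∎)

      σ-homomorphic : ∀ {_∙ₖ_ : F.Carrier → F.Carrier → F.Carrier} {_∙ₗ_ : Carrier → Carrier → Carrier} →
                      (∀ a b → ι (a ∙ₖ b) ≡ ι a ∙ₗ ι b) → (∀ x y → τ (x ∙ₗ y) ≡ τ x ∙ₗ τ y) →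
                      ∀ a b → σ (a ∙ₖ b) ≡ σ a ∙ₖ σ b
      σ-homomorphic {_∙ₖ_} {_∙ₗ_} ι-∙ τ-∙ a b = ι-injective (begin
        ι (σ (a ∙ₖ b))          ≡⟨ ι∘σ≡τ∘ι (a ∙ₖ b) ⟩
        τ (ι (a ∙ₖ b))          ≡⟨ ≡.cong τ (ι-∙ a b) ⟩
        τ (ι a ∙ₗ ι b)          ≡⟨ τ-∙ (ι a) (ι b) ⟩
        τ (ι a) ∙ₗ τ (ι b)      ≡⟨ ≡.cong₂ _∙ₗ_ (ι∘σ≡τ∘ι a) (ι∘σ≡τ∘ι b) ⟨
        ι (σ a) ∙ₗ ι (σ b)      ≡⟨ ι-∙ (σ a) (σ b) ⟨
        ι (σ a ∙ₖ σ b)          ∎)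

    σ-automorphism : IsFieldAutomorphism F σ
    σ-automorphism = record
      { bijective = (λ {a} {b} σa≡σb → ι-injective (proj₁ τ-bijective (begin
                        τ (ι a)  ≡⟨ ι∘σ≡τ∘ι a ⟨
                        ι (σ a)  ≡⟨ ≡.cong ι σa≡σb ⟩
                        ι (σ b)  ≡⟨ ι∘σ≡τ∘ι b ⟩
                        τ (ι b)  ∎)))
                  , λ b → proj₁ (σ-surjective b) , λ z≡a → ≡.trans (≡.cong σ z≡a) (proj₂ (σ-surjective b))
      ; pres-+ = σ-homomorphic {F._+_} {_+_} pres-+ τ-+
      ; pres-* = σ-homomorphic {F._*_} {_*_} pres-* τ-*
      }

  semilinear-maps-span : ∀ {τ g u u'} → IsSemilinearE τ g → u' ≢ 0V → SamePoint (g u) u' →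
                         MapsOnto g (fieldReduction u) (fieldReduction u')
  semilinear-maps-span {τ} {g} {u} {u'} g-semilinear u'≢0 (μ , u'≡μgu) = into , onto
    where
    open IsSemilinearE g-semilinear
    open IsFieldAutomorphism automorphism using () renaming (bijective to τ-bijective)
    μ≢0 : μ ≢ 0#
    μ≢0 μ≡0 = u'≢0 (≡.trans u'≡μgu (≡.trans (≡.cong (_• g u) μ≡0) (•-zeroˡ (g u))))
    μ⁻¹ : Carrier
    μ⁻¹ = inv μ μ≢0
    gu≡μ⁻¹u' : g u ≡ μ⁻¹ • u'
    gu≡μ⁻¹u' = begin
      g u             ≡⟨ •-identityˡ (g u) ⟨
      1# • g u        ≡⟨ ≡.cong (_• g u) (*-inverseˡ μ μ≢0) ⟨
      (μ⁻¹ * μ) • g u ≡⟨ •-assoc μ⁻¹ μ (g u) ⟨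
      μ⁻¹ • (μ • g u) ≡⟨ ≡.cong (μ⁻¹ •_) u'≡μgu ⟨
      μ⁻¹ • u'        ∎
    into : ∀ x → fieldReduction u x → fieldReduction u' (g x)
    into x (l , ≡.refl) = τ l * μ⁻¹ , (begin
      g (l • u)          ≡⟨ semilinear l u ⟩
      τ l • g u          ≡⟨ ≡.cong (τ l •_) gu≡μ⁻¹u' ⟩
      τ l • (μ⁻¹ • u')   ≡⟨ •-assoc (τ l) μ⁻¹ u' ⟩
      (τ l * μ⁻¹) • u'   ∎)
    onto : ∀ y → fieldReduction u' y → ∃[ x ] (fieldReduction u x × g x ≡ y)
    onto y (c , ≡.refl) with proj₂ τ-bijective (c * μ)
    ... | l , τl≡cμ = l • u , (l , ≡.refl) , (begin
      g (l • u)          ≡⟨ semilinear l u ⟩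
      τ l • g u          ≡⟨ ≡.cong (_• g u) (τl≡cμ ≡.refl) ⟩
      (c * μ) • g u      ≡⟨ •-assoc c μ (g u) ⟨
      c • (μ • g u)      ≡⟨ ≡.cong (c •_) u'≡μgu ⟨
      c • u'             ∎)

  oval-equivalence⇒pseudo-oval-equivalence : ∀ {m} (O₁ O₂ : Fin m → V) → (∀ j → O₂ j ≢ 0V) →
    OvalEquivalent O₁ O₂ → SubspaceSetEquivalent (elementaryPseudoOval O₁) (elementaryPseudoOval O₂)
  oval-equivalence⇒pseudo-oval-equivalence O₁ O₂ O₂≢0 (τ , g , g-semilinear , images , preimages) =
    σ , g , g-semilinearF , (λ i → proj₁ (images i) , maps (proj₂ (images i)))
                          , (λ j → proj₁ (preimages j) , maps (proj₂ (preimages j)))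
    where
    open IsSemilinearE g-semilinear
    open Restriction automorphism
    g-semilinearF : IsSemilinearF σ g
    g-semilinearF = record
      { automorphism = σ-automorphism ; bijective = bijective ; additive = additive
      ; semilinear = λ a x → ≡.trans (semilinear (ι a) x) (≡.cong (_• g x) (≡.sym (ι∘σ≡τ∘ι a))) }
    maps : ∀ {i j} → SamePoint (g (O₁ i)) (O₂ j) → MapsOnto g (elementaryPseudoOval O₁ i) (elementaryPseudoOval O₂ j)
    maps {j = j} = semilinear-maps-span g-semilinear (O₂≢0 j)

module PseudoOvalToOval (F E : Field) (ι : Field.Carrier F → Field.Carrier E) (_≟_ : DecidableEquality (Field.Carrier E)) where

  open Plane F E ι _≟_
  open ≡.≡-Reasoning

  Additive : (V → V) → Set
  Additive φ = ∀ x y → φ (x ⊕ y) ≡ φ x ⊕ φ y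

  PreservesSpan : (V → V) → V → Set
  PreservesSpan φ x = ∀ l → ∃[ t ] (φ (l • x) ≡ t • φ x)

  module AdditiveMap {φ : V → V} (additive : Additive φ) where

    φ-0 : φ 0V ≡ 0V
    φ-0 = x⊕x≡x⇒x≡0 (≡.trans (≡.sym (additive 0V 0V)) (≡.cong φ (⊕-identityʳ 0V)))

    φ-nonzero : Injective _≡_ _≡_ φ → ∀ {x} → x ≢ 0V → φ x ≢ 0V
    φ-nonzero φ-injective x≢0 φx≡0 = x≢0 (φ-injective (≡.trans φx≡0 (≡.sym φ-0)))

    φ-combination : ∀ a b c u v w → φ (combination a b c u v w) ≡ (φ (a • u) ⊕ φ (b • v)) ⊕ φ (c • w)
    φ-combination a b c u v w = ≡.trans (additive _ (c • w)) (≡.cong (_⊕ φ (c • w)) (additive (a • u) (b • v)))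

    maps-into⇒preserves-span : ∀ {u u' x} → (∀ y → fieldReduction u y → fieldReduction u' (φ y)) →
                               fieldReduction u x → φ x ≢ 0V → PreservesSpan φ x
    maps-into⇒preserves-span {u} {u'} {x} into (s , x≡su) φx≢0 l
      with into x (s , x≡su) | into (l • x) (l * s , ≡.trans (≡.cong (l •_) x≡su) (•-assoc l s u))
    ... | c , φx≡cu' | c' , φlx≡c'u' = c' * inv c c≢0 , (begin
      φ (l • x)                       ≡⟨ φlx≡c'u' ⟩
      c' • u'                         ≡⟨ ≡.cong (_• u') (*-identityʳ c') ⟨
      (c' * 1#) • u'                  ≡⟨ ≡.cong (λ t → (c' * t) • u') (*-inverseˡ c c≢0) ⟨
      (c' * (inv c c≢0 * c)) • u'     ≡⟨ ≡.cong (_• u') (*-assoc c' _ c) ⟨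
      ((c' * inv c c≢0) * c) • u'     ≡⟨ •-assoc _ c u' ⟨
      (c' * inv c c≢0) • (c • u')     ≡⟨ ≡.cong ((c' * inv c c≢0) •_) φx≡cu' ⟨
      (c' * inv c c≢0) • φ x          ∎)
      where
      c≢0 : c ≢ 0#
      c≢0 c≡0 = φx≢0 (≡.trans φx≡cu' (≡.trans (≡.cong (_• u') c≡0) (•-zeroˡ u')))

    maps-onto⇒same-point : Injective _≡_ _≡_ φ → ∀ {u u'} → u ≢ 0V →
                           MapsOnto φ (fieldReduction u) (fieldReduction u') → SamePoint (φ u) u'
    maps-onto⇒same-point φ-injective {u} {u'} u≢0 (into , _) with into u (1# , ≡.sym (•-identityˡ u))
    ... | c , φu≡cu' = inv c c≢0 , (begin
      u'                        ≡⟨ •-identityˡ u' ⟨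
      1# • u'                   ≡⟨ ≡.cong (_• u') (*-inverseˡ c c≢0) ⟨
      (inv c c≢0 * c) • u'      ≡⟨ •-assoc _ c u' ⟨
      inv c c≢0 • (c • u')      ≡⟨ ≡.cong (inv c c≢0 •_) φu≡cu' ⟨
      inv c c≢0 • φ u           ∎)
      where
      c≢0 : c ≢ 0#
      c≢0 c≡0 = φ-nonzero φ-injective u≢0 (≡.trans φu≡cu' (≡.trans (≡.cong (_• u') c≡0) (•-zeroˡ u')))

  module Frame {φ : V → V} (additive : Additive φ) (bijective : Bijective _≡_ _≡_ φ)
    {e₁ e₂ e₃ : V} (D≢0 : det e₁ e₂ e₃ ≢ 0#) (D'≢0 : det (φ e₁) (φ e₂) (φ e₃) ≢ 0#)
    (span₁ : PreservesSpan φ e₁) (span₂ : PreservesSpan φ e₂) (span₃ : PreservesSpan φ e₃)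
    (span-unit : PreservesSpan φ ((e₁ ⊕ e₂) ⊕ e₃)) where

    open AdditiveMap additive
    module e = Basis D≢0
    private
      module w = Basis D'≢0
      w₁ w₂ w₃ : V
      w₁ = φ e₁
      w₂ = φ e₂
      w₃ = φ e₃

      e₁≢0 : e₁ ≢ 0V
      e₁≢0 e₁≡0 = D≢0 (≡.trans (≡.cong (λ x → det x e₂ e₃) e₁≡0) (det-zeroˡ e₂ e₃))

      w₁≢0 : w₁ ≢ 0V
      w₁≢0 w₁≡0 = D'≢0 (≡.trans (≡.cong (λ x → det x w₂ w₃) w₁≡0) (det-zeroˡ w₂ w₃))

    τ : Carrier → Carrier
    τ l = proj₁ (span₁ l)

    τ-spec : ∀ l → φ (l • e₁) ≡ τ l • w₁
    τ-spec l = proj₂ (span₁ l)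

    private
      τ₂ τ₃ : Carrier → Carrier
      τ₂ l = proj₁ (span₂ l)
      τ₃ l = proj₁ (span₃ l)

      φ-combination′ : ∀ a b c → φ (combination a b c e₁ e₂ e₃) ≡ combination (τ a) (τ₂ b) (τ₃ c) w₁ w₂ w₃
      φ-combination′ a b c = ≡.trans (φ-combination a b c e₁ e₂ e₃)
        (≡.cong₂ _⊕_ (≡.cong₂ _⊕_ (τ-spec a) (proj₂ (span₂ b))) (proj₂ (span₃ c)))

      -- the three scalar maps agree because φ also scales the unit point e₁ ⊕ e₂ ⊕ e₃
      τ₂≡τ×τ₃≡τ : ∀ l → τ₂ l ≡ τ l × τ₃ l ≡ τ l
      τ₂≡τ×τ₃≡τ l = ≡.trans τ₂l≡μ (≡.sym τl≡μ) , ≡.trans τ₃l≡μ (≡.sym τl≡μ)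
        where
        μ : Carrier
        μ = proj₁ (span-unit l)
        •-distrib-sum : ∀ {u v w} t → t • ((u ⊕ v) ⊕ w) ≡ combination t t t u v w
        •-distrib-sum {u} {v} {w} t = ≡.trans (•-distribˡ t (u ⊕ v) w) (≡.cong (_⊕ (t • w)) (•-distribˡ t u v))
        φ-unit : φ ((e₁ ⊕ e₂) ⊕ e₃) ≡ (w₁ ⊕ w₂) ⊕ w₃
        φ-unit = ≡.trans (additive _ e₃) (≡.cong (_⊕ w₃) (additive e₁ e₂))
        φ[l•unit] : combination (τ l) (τ₂ l) (τ₃ l) w₁ w₂ w₃ ≡ combination μ μ μ w₁ w₂ w₃
        φ[l•unit] = begin
          combination (τ l) (τ₂ l) (τ₃ l) w₁ w₂ w₃   ≡⟨ φ-combination′ l l l ⟨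
          φ (combination l l l e₁ e₂ e₃)             ≡⟨ ≡.cong φ (•-distrib-sum l) ⟨
          φ (l • ((e₁ ⊕ e₂) ⊕ e₃))                   ≡⟨ proj₂ (span-unit l) ⟩
          μ • φ ((e₁ ⊕ e₂) ⊕ e₃)                     ≡⟨ ≡.cong (μ •_) φ-unit ⟩
          μ • ((w₁ ⊕ w₂) ⊕ w₃)                       ≡⟨ •-distrib-sum μ ⟩
          combination μ μ μ w₁ w₂ w₃                 ∎
        τl≡μ : τ l ≡ μ
        τl≡μ = proj₁ (w.combination-injective (τ l) (τ₂ l) (τ₃ l) μ μ μ φ[l•unit])
        τ₂l≡μ : τ₂ l ≡ μ
        τ₂l≡μ = proj₁ (proj₂ (w.combination-injective (τ l) (τ₂ l) (τ₃ l) μ μ μ φ[l•unit]))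
        τ₃l≡μ : τ₃ l ≡ μ
        τ₃l≡μ = proj₂ (proj₂ (w.combination-injective (τ l) (τ₂ l) (τ₃ l) μ μ μ φ[l•unit]))

    φ-combination-τ : ∀ a b c → φ (combination a b c e₁ e₂ e₃) ≡ combination (τ a) (τ b) (τ c) w₁ w₂ w₃
    φ-combination-τ a b c = ≡.trans (φ-combination′ a b c)
      (≡.cong₂ (λ s t → combination (τ a) s t w₁ w₂ w₃) (proj₁ (τ₂≡τ×τ₃≡τ b)) (proj₂ (τ₂≡τ×τ₃≡τ c)))

    τ-0 : τ 0# ≡ 0#
    τ-0 = •-cancelʳ w₁≢0 (begin
      τ 0# • w₁      ≡⟨ τ-spec 0# ⟨
      φ (0# • e₁)    ≡⟨ ≡.cong φ (•-zeroˡ e₁) ⟩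
      φ 0V           ≡⟨ φ-0 ⟩
      0V             ≡⟨ •-zeroˡ w₁ ⟨
      0# • w₁        ∎)

    τ-1 : τ 1# ≡ 1#
    τ-1 = •-cancelʳ w₁≢0 (begin
      τ 1# • w₁     ≡⟨ τ-spec 1# ⟨
      φ (1# • e₁)   ≡⟨ ≡.cong φ (•-identityˡ e₁) ⟩
      w₁            ≡⟨ •-identityˡ w₁ ⟨
      1# • w₁       ∎)

    τ-+ : ∀ a b → τ (a + b) ≡ τ a + τ b
    τ-+ a b = •-cancelʳ w₁≢0 (begin
      τ (a + b) • w₁               ≡⟨ τ-spec (a + b) ⟨
      φ ((a + b) • e₁)             ≡⟨ ≡.cong φ (•-distribʳ a b e₁) ⟩
      φ ((a • e₁) ⊕ (b • e₁))      ≡⟨ additive (a • e₁) (b • e₁) ⟩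
      φ (a • e₁) ⊕ φ (b • e₁)      ≡⟨ ≡.cong₂ _⊕_ (τ-spec a) (τ-spec b) ⟩
      (τ a • w₁) ⊕ (τ b • w₁)      ≡⟨ •-distribʳ (τ a) (τ b) w₁ ⟨
      (τ a + τ b) • w₁             ∎)

    τ-injective : Injective _≡_ _≡_ τ
    τ-injective {a} {b} τa≡τb = •-cancelʳ e₁≢0 (proj₁ bijective (begin
      φ (a • e₁)   ≡⟨ τ-spec a ⟩
      τ a • w₁     ≡⟨ ≡.cong (_• w₁) τa≡τb ⟩
      τ b • w₁     ≡⟨ τ-spec b ⟨
      φ (b • e₁)   ∎))

    τ-nonzero : ∀ {a} → a ≢ 0# → τ a ≢ 0#
    τ-nonzero a≢0 τa≡0 = a≢0 (τ-injective (≡.trans τa≡0 (≡.sym τ-0)))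

    τ-surjective : ∀ y → ∃[ a ] τ a ≡ y
    τ-surjective y = e.coordinate₁ z , proj₁ (w.combination-injective _ _ _ y 0# 0# (begin
      combination (τ (e.coordinate₁ z)) (τ (e.coordinate₂ z)) (τ (e.coordinate₃ z)) w₁ w₂ w₃
        ≡⟨ φ-combination-τ _ _ _ ⟨
      φ (combination (e.coordinate₁ z) (e.coordinate₂ z) (e.coordinate₃ z) e₁ e₂ e₃)
        ≡⟨ ≡.cong φ (e.expansion z) ⟨
      φ z
        ≡⟨ proj₂ (proj₂ bijective (y • w₁)) ≡.refl ⟩
      y • w₁
        ≡⟨ ≡.trans (⊕-identityʳ _) (⊕-identityʳ _) ⟨
      ((y • w₁) ⊕ 0V) ⊕ 0V
        ≡⟨ ≡.cong₂ (λ s t → ((y • w₁) ⊕ s) ⊕ t) (•-zeroˡ w₂) (•-zeroˡ w₃) ⟨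
      combination y 0# 0# w₁ w₂ w₃
        ∎))
      where
      z : V
      z = proj₁ (proj₂ bijective (y • w₁))

    φ-scaled : ∀ l x → φ (l • x) ≡
      combination (τ (l * e.coordinate₁ x)) (τ (l * e.coordinate₂ x)) (τ (l * e.coordinate₃ x)) w₁ w₂ w₃
    φ-scaled l x = begin
      φ (l • x)                                                    ≡⟨ ≡.cong (λ y → φ (l • y)) (e.expansion x) ⟩
      φ (l • combination a b c e₁ e₂ e₃)                           ≡⟨ ≡.cong φ (•-combination l a b c e₁ e₂ e₃) ⟩
      φ (combination (l * a) (l * b) (l * c) e₁ e₂ e₃)             ≡⟨ φ-combination-τ (l * a) (l * b) (l * c) ⟩
      combination (τ (l * a)) (τ (l * b)) (τ (l * c)) w₁ w₂ w₃     ∎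
      where
      a b c : Carrier
      a = e.coordinate₁ x ; b = e.coordinate₂ x ; c = e.coordinate₃ x

    φ-expansion : ∀ x → φ x ≡ combination (τ (e.coordinate₁ x)) (τ (e.coordinate₂ x)) (τ (e.coordinate₃ x)) w₁ w₂ w₃
    φ-expansion x = ≡.trans (≡.cong φ (e.expansion x)) (φ-combination-τ _ _ _)

    -- φ maps t • x to a multiple of φ x, so the τ-images of the coordinates of t • x are
    -- proportional to those of x.
    cross-relation : ∀ {x} → PreservesSpan φ x → ∀ t →
                     τ (t * e.coordinate₂ x) * τ (e.coordinate₁ x) ≡ τ (t * e.coordinate₁ x) * τ (e.coordinate₂ x)
    cross-relation {x} span t = begin
      τ (t * b) * τ a        ≡⟨ ≡.cong (_* τ a) τtb≡μτb ⟩
      (μ * τ b) * τ a        ≡⟨ solve 3 (λ m y z → m :* y :* z := m :* z :* y) ≡.refl μ (τ b) (τ a) ⟩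
      (μ * τ a) * τ b        ≡⟨ ≡.cong (_* τ b) τta≡μτa ⟨
      τ (t * a) * τ b        ∎
      where
      a b c μ : Carrier
      a = e.coordinate₁ x ; b = e.coordinate₂ x ; c = e.coordinate₃ x
      μ = proj₁ (span t)
      proportional : combination (τ (t * a)) (τ (t * b)) (τ (t * c)) w₁ w₂ w₃ ≡
                     combination (μ * τ a) (μ * τ b) (μ * τ c) w₁ w₂ w₃
      proportional = begin
        combination (τ (t * a)) (τ (t * b)) (τ (t * c)) w₁ w₂ w₃   ≡⟨ φ-scaled t x ⟨
        φ (t • x)                                                  ≡⟨ proj₂ (span t) ⟩
        μ • φ x                                                    ≡⟨ ≡.cong (μ •_) (φ-expansion x) ⟩
        μ • combination (τ a) (τ b) (τ c) w₁ w₂ w₃                 ≡⟨ •-combination μ (τ a) (τ b) (τ c) w₁ w₂ w₃ ⟩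
        combination (μ * τ a) (μ * τ b) (μ * τ c) w₁ w₂ w₃         ∎
      τta≡μτa : τ (t * a) ≡ μ * τ a
      τta≡μτa = proj₁ (w.combination-injective _ _ _ _ _ _ proportional)
      τtb≡μτb : τ (t * b) ≡ μ * τ b
      τtb≡μτb = proj₁ (proj₂ (w.combination-injective _ _ _ _ _ _ proportional))

    ratio : (x : V) → e.coordinate₁ x ≢ 0# → Carrier
    ratio x a≢0 = e.coordinate₂ x * inv (e.coordinate₁ x) a≢0

    ratio-multiplicative : ∀ {x} → PreservesSpan φ x → (a≢0 : e.coordinate₁ x ≢ 0#) →
                           ∀ l → τ (l * ratio x a≢0) ≡ τ l * τ (ratio x a≢0)
    ratio-multiplicative {x} span a≢0 l = *-cancelʳ (τ-nonzero a≢0) (begin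
      τ (l * r) * τ a        ≡⟨ scaled-by l ⟩
      τ l * τ b              ≡⟨ ≡.cong (τ l *_) τr*τa≡τb ⟨
      τ l * (τ r * τ a)      ≡⟨ *-assoc (τ l) (τ r) (τ a) ⟨
      (τ l * τ r) * τ a      ∎)
      where
      a b r a⁻¹ : Carrier
      a = e.coordinate₁ x ; b = e.coordinate₂ x
      r = ratio x a≢0
      a⁻¹ = inv a a≢0

      scaled-by : ∀ t → τ (t * r) * τ a ≡ τ t * τ b
      scaled-by t = begin
        τ (t * r) * τ a
          ≡⟨ ≡.cong (λ s → τ s * τ a) (solve 3 (λ t b i → t :* (b :* i) := (t :* i) :* b) ≡.refl t b a⁻¹) ⟩
        τ ((t * a⁻¹) * b) * τ a
          ≡⟨ cross-relation span (t * a⁻¹) ⟩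
        τ ((t * a⁻¹) * a) * τ b
          ≡⟨ ≡.cong (λ s → τ s * τ b) (≡.trans (*-assoc t a⁻¹ a) (≡.trans (≡.cong (t *_) (*-inverseˡ a a≢0)) (*-identityʳ t))) ⟩
        τ t * τ b
          ∎

      τr*τa≡τb : τ r * τ a ≡ τ b
      τr*τa≡τb = begin
        τ r * τ a         ≡⟨ ≡.cong (λ t → τ t * τ a) (*-identityˡ r) ⟨
        τ (1# * r) * τ a  ≡⟨ scaled-by 1# ⟩
        τ 1# * τ b        ≡⟨ ≡.cong (_* τ b) τ-1 ⟩
        1# * τ b          ≡⟨ *-identityˡ (τ b) ⟩
        τ b               ∎

    module _ (τ-* : ∀ a b → τ (a * b) ≡ τ a * τ b) where

      τ-automorphism : IsFieldAutomorphism E τ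
      τ-automorphism = record
        { bijective = τ-injective , λ y → proj₁ (τ-surjective y) , λ z≡a → ≡.trans (≡.cong τ z≡a) (proj₂ (τ-surjective y))
        ; pres-+ = τ-+
        ; pres-* = τ-* }

      φ-semilinear : IsSemilinearE τ φ
      φ-semilinear = record
        { automorphism = τ-automorphism ; bijective = bijective ; additive = additive
        ; semilinear = semilinear }
        where
        semilinear : ∀ l x → φ (l • x) ≡ τ l • φ x
        semilinear l x = begin
          φ (l • x)                                                 ≡⟨ φ-scaled l x ⟩
          combination (τ (l * a)) (τ (l * b)) (τ (l * c)) w₁ w₂ w₃  ≡⟨ ≡.cong₂ (λ s t → combination s t (τ (l * c)) w₁ w₂ w₃) (τ-* l a) (τ-* l b) ⟩
          combination (τ l * τ a) (τ l * τ b) (τ (l * c)) w₁ w₂ w₃  ≡⟨ ≡.cong (λ u → combination (τ l * τ a) (τ l * τ b) u w₁ w₂ w₃) (τ-* l c) ⟩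
          combination (τ l * τ a) (τ l * τ b) (τ l * τ c) w₁ w₂ w₃  ≡⟨ •-combination (τ l) (τ a) (τ b) (τ c) w₁ w₂ w₃ ⟨
          τ l • combination (τ a) (τ b) (τ c) w₁ w₂ w₃              ≡⟨ ≡.cong (τ l •_) (φ-expansion x) ⟨
          τ l • φ x                                                 ∎
          where
          a b c : Carrier
          a = e.coordinate₁ x ; b = e.coordinate₂ x ; c = e.coordinate₃ x

  module ArcFrame {k : ℕ} (cardE : Carrier ↔ Fin (3 ℕ.+ k))
    {O₁ O₂ : Fin (4 ℕ.+ k) → V} (arc₁ : IsArc O₁) (arc₂ : IsArc O₂)
    {σ φ} (φ-semilinearF : IsSemilinearF σ φ)
    (images : ∀ i → ∃[ j ] MapsOnto φ (elementaryPseudoOval O₁ i) (elementaryPseudoOval O₂ j)) where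

    open IsSemilinearF φ-semilinearF using (additive; bijective)
    open AdditiveMap additive

    private
      image : Fin (4 ℕ.+ k) → Fin (4 ℕ.+ k)
      image i = proj₁ (images i)

      maps-into : ∀ i x → fieldReduction (O₁ i) x → fieldReduction (O₂ (image i)) (φ x)
      maps-into i = proj₁ (proj₂ (images i))

      φ-represents : ∀ {i x} → Represents (O₁ i) x → Represents (O₂ (image i)) (φ x)
      φ-represents {i} (x∈ , x≢0) = maps-into i _ x∈ , φ-nonzero (proj₁ bijective) x≢0

      preserves-span : ∀ {i x} → Represents (O₁ i) x → PreservesSpan φ x
      preserves-span {i} (x∈ , x≢0) = maps-into⇒preserves-span (maps-into i) x∈ (φ-nonzero (proj₁ bijective) x≢0)

      image-injective : ∀ {i i'} → i ≢ i' → image i ≢ image i'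
      image-injective {i} {i'} i≢i' image≡ = IsArc.distinct arc₁ i i' i≢i'
        (≡.subst (fieldReduction (O₁ i)) (proj₁ bijective (proj₂ (proj₂ preimage))) (proj₁ (proj₂ preimage)))
        where
        φOᵢ'∈ : fieldReduction (O₂ (image i)) (φ (O₁ i'))
        φOᵢ'∈ = ≡.subst (λ j → fieldReduction (O₂ j) (φ (O₁ i'))) (≡.sym image≡)
                  (maps-into i' _ (proj₁ (point-represents arc₁ i')))
        preimage : ∃[ z ] (fieldReduction (O₁ i) z × φ z ≡ φ (O₁ i'))
        preimage = proj₂ (proj₂ (images i)) _ φOᵢ'∈

      other : Fin (suc k) → Fin (4 ℕ.+ k)
      other i = suc (suc (suc i))

      module u = Basis (arc-det≢0 arc₁ {0F} {1F} {2F} (λ ()) (λ ()) (λ ()))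

      p : V
      p = O₁ 3F

      p-coordinates≢0 : u.coordinate₁ p ≢ 0# × u.coordinate₂ p ≢ 0# × u.coordinate₃ p ≢ 0#
      p-coordinates≢0 =
          *-nonzero (inv-nonzero _ _) (arc-det≢0 arc₁ {3F} {1F} {2F} (λ ()) (λ ()) (λ ()))
        , *-nonzero (inv-nonzero _ _) (arc-det≢0 arc₁ {0F} {3F} {2F} (λ ()) (λ ()) (λ ()))
        , *-nonzero (inv-nonzero _ _) (arc-det≢0 arc₁ {0F} {1F} {3F} (λ ()) (λ ()) (λ ()))

      scaled-point : ∀ {i a} → a ≢ 0# → Represents (O₁ i) (a • O₁ i)
      scaled-point {i} a≢0 = (_ , ≡.refl) , •-nonzero a≢0 (IsArc.nonzero arc₁ i)

      e₁ e₂ e₃ : V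
      e₁ = u.coordinate₁ p • O₁ 0F
      e₂ = u.coordinate₂ p • O₁ 1F
      e₃ = u.coordinate₃ p • O₁ 2F

      e₁-represents : Represents (O₁ 0F) e₁
      e₁-represents = scaled-point (proj₁ p-coordinates≢0)
      e₂-represents : Represents (O₁ 1F) e₂
      e₂-represents = scaled-point (proj₁ (proj₂ p-coordinates≢0))
      e₃-represents : Represents (O₁ 2F) e₃
      e₃-represents = scaled-point (proj₂ (proj₂ p-coordinates≢0))

      D≢0 : det e₁ e₂ e₃ ≢ 0#
      D≢0 = representatives-det≢0 arc₁ (λ ()) (λ ()) (λ ()) e₁-represents e₂-represents e₃-represents

      D'≢0 : det (φ e₁) (φ e₂) (φ e₃) ≢ 0#
      D'≢0 = representatives-det≢0 arc₂ (image-injective (λ ())) (image-injective (λ ())) (image-injective (λ ()))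
               (φ-represents e₁-represents) (φ-represents e₂-represents) (φ-represents e₃-represents)

    open Frame additive bijective D≢0 D'≢0
      (preserves-span e₁-represents) (preserves-span e₂-represents) (preserves-span e₃-represents)
      (≡.subst (PreservesSpan φ) (u.expansion p) (preserves-span (point-represents arc₁ 3F)))

    private
      x : Fin (suc k) → V
      x i = O₁ (other i)

      x-coordinate₁≢0 : ∀ i → e.coordinate₁ (x i) ≢ 0#
      x-coordinate₁≢0 i = *-nonzero (inv-nonzero _ D≢0)
        (representatives-det≢0 arc₁ {other i} (λ ()) (λ ()) (λ ())
          (point-represents arc₁ (other i)) e₂-represents e₃-represents)

      x-coordinate₂≢0 : ∀ i → e.coordinate₂ (x i) ≢ 0#
      x-coordinate₂≢0 i = *-nonzero (inv-nonzero _ D≢0)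
        (representatives-det≢0 arc₁ {0F} {other i} (λ ()) (λ ()) (λ ())
          e₁-represents (point-represents arc₁ (other i)) e₃-represents)

      r : Fin (suc k) → Carrier
      r i = ratio (x i) (x-coordinate₁≢0 i)

      r≢0 : ∀ i → r i ≢ 0#
      r≢0 i = *-nonzero (x-coordinate₂≢0 i) (inv-nonzero _ (x-coordinate₁≢0 i))

      -- equal ratios would put e₃, x i and x i' on a line
      r-injective : Injective _≡_ _≡_ r
      r-injective {i} {i'} rᵢ≡rᵢ' = decidable-stable (i Fin.≟ i') λ i≢i' →
        representatives-det≢0 arc₁ {2F} {other i} {other i'} (λ ()) (λ ()) (i≢i' ∘ other-injective)
          e₃-represents (point-represents arc₁ (other i)) (point-represents arc₁ (other i')) (begin
        det e₃ (x i) (x i')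
          ≡⟨ ≡.cong₂ (det e₃) (e.expansion (x i)) (e.expansion (x i')) ⟩
        det e₃ (combination (c₁ i) (c₂ i) (c₃ i) e₁ e₂ e₃) (combination (c₁ i') (c₂ i') (c₃ i') e₁ e₂ e₃)
          ≡⟨ det-two-combinations (c₁ i) (c₂ i) (c₃ i) (c₁ i') (c₂ i') (c₃ i') e₁ e₂ e₃ ⟩
        (c₁ i * c₂ i' - c₁ i' * c₂ i) * det e₃ e₁ e₂
          ≡⟨ ≡.cong (λ t → (t - c₁ i' * c₂ i) * det e₃ e₁ e₂)
                    (cross-multiply (x-coordinate₁≢0 i) (x-coordinate₁≢0 i') rᵢ≡rᵢ') ⟩
        (c₁ i' * c₂ i - c₁ i' * c₂ i) * det e₃ e₁ e₂
          ≡⟨ ≡.cong (_* det e₃ e₁ e₂) (-‿inverseʳ _) ⟩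
        0# * det e₃ e₁ e₂
          ≡⟨ zeroˡ _ ⟩
        0# ∎)
        where
        c₁ c₂ c₃ : Fin (suc k) → Carrier
        c₁ i = e.coordinate₁ (x i)
        c₂ i = e.coordinate₂ (x i)
        c₃ i = e.coordinate₃ (x i)
        other-injective : Injective _≡_ _≡_ other
        other-injective = Fin.suc-injective ∘ Fin.suc-injective ∘ Fin.suc-injective

      Multiplicative : Carrier → Set
      Multiplicative y = ∀ l → τ (l * y) ≡ τ l * τ y

      multiplicative-0 : Multiplicative 0#
      multiplicative-0 l = begin
        τ (l * 0#)   ≡⟨ ≡.cong τ (zeroʳ l) ⟩
        τ 0#         ≡⟨ τ-0 ⟩
        0#           ≡⟨ zeroʳ (τ l) ⟨
        τ l * 0#     ≡⟨ ≡.cong (τ l *_) τ-0 ⟨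
        τ l * τ 0#   ∎

      multiplicative-suc : ∀ {y} → Multiplicative y → Multiplicative (y + 1#)
      multiplicative-suc {y} τ-*y l = begin
        τ (l * (y + 1#))           ≡⟨ ≡.cong τ (distribˡ l y 1#) ⟩
        τ (l * y + l * 1#)         ≡⟨ τ-+ (l * y) (l * 1#) ⟩
        τ (l * y) + τ (l * 1#)     ≡⟨ ≡.cong₂ _+_ (τ-*y l) (≡.cong τ (*-identityʳ l)) ⟩
        τ l * τ y + τ l            ≡⟨ ≡.cong (τ l * τ y +_) (≡.trans (≡.cong (τ l *_) τ-1) (*-identityʳ (τ l))) ⟨
        τ l * τ y + τ l * τ 1#     ≡⟨ distribˡ (τ l) (τ y) (τ 1#) ⟨
        τ l * (τ y + τ 1#)         ≡⟨ ≡.cong (τ l *_) (τ-+ y 1#) ⟨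
        τ l * τ (y + 1#)           ∎

    τ-* : ∀ a b → τ (a * b) ≡ τ a * τ b
    τ-* l y = decidable-stable (τ (l * y) ≟ (τ l * τ y)) λ τ[ly]≢τlτy →
      FiniteField.+1-closed-saturates E cardE Multiplicative multiplicative-0 multiplicative-suc
        r r-injective r≢0 (λ i → ratio-multiplicative (preserves-span (point-represents arc₁ (other i))) (x-coordinate₁≢0 i))
        ℕ.≤-refl y (λ τ-*y → τ[ly]≢τlτy (τ-*y l))

    semilinear : ∃[ τ ] IsSemilinearE τ φ
    semilinear = τ , φ-semilinear τ-*

  private
    zero-or-one : Carrier ↔ Fin 2 → ∀ l → l ≡ 0# ⊎ l ≡ 1#
    zero-or-one card l = Sum.map index-injective index-injective (other-or-same (index 0#) (index 1#) (index l) (0≢1 ∘ index-injective))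
      where
      open Inverse card using () renaming (to to index)
      index-injective : ∀ {a b} → index a ≡ index b → a ≡ b
      index-injective = Injection.injective (↔⇒↣ card)
      other-or-same : ∀ (a b c : Fin 2) → a ≢ b → c ≡ a ⊎ c ≡ b
      other-or-same 0F 0F _  a≢b = ⊥-elim (a≢b ≡.refl)
      other-or-same 1F 1F _  a≢b = ⊥-elim (a≢b ≡.refl)
      other-or-same 0F 1F 0F _   = inj₁ ≡.refl
      other-or-same 0F 1F 1F _   = inj₂ ≡.refl
      other-or-same 1F 0F 0F _   = inj₂ ≡.refl
      other-or-same 1F 0F 1F _   = inj₁ ≡.refl

  additive-linear-over-two-elements : Carrier ↔ Fin 2 → ∀ {φ} → Additive φ → ∀ l x → φ (l • x) ≡ l • φ x
  additive-linear-over-two-elements card {φ} additive l x with zero-or-one card l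
  ... | inj₁ ≡.refl = ≡.trans (≡.cong φ (•-zeroˡ x)) (≡.trans (AdditiveMap.φ-0 additive) (≡.sym (•-zeroˡ (φ x))))
  ... | inj₂ ≡.refl = ≡.trans (≡.cong φ (•-identityˡ x)) (≡.sym (•-identityˡ (φ x)))

  identity-automorphism : IsFieldAutomorphism E (λ x → x)
  identity-automorphism = record
    { bijective = (λ x≡y → x≡y) , (λ y → y , λ z≡y → z≡y) ; pres-+ = λ _ _ → ≡.refl ; pres-* = λ _ _ → ≡.refl }

  E-semilinear : ∀ {N} → Carrier ↔ Fin N → {O₁ O₂ : Fin (suc N) → V} → IsArc O₁ → IsArc O₂ →
                 ∀ {σ φ} → IsSemilinearF σ φ →
                 (∀ i → ∃[ j ] MapsOnto φ (elementaryPseudoOval O₁ i) (elementaryPseudoOval O₂ j)) →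
                 ∃[ τ ] IsSemilinearE τ φ
  E-semilinear {zero}              cardE _    _    _            _      = ⊥-elim (ℕ.<⇒≱ (ℕ.s≤s ℕ.z≤n) (FiniteField.size≥2 E cardE))
  E-semilinear {suc zero}          cardE _    _    _            _      = ⊥-elim (ℕ.<⇒≱ ℕ.≤-refl (FiniteField.size≥2 E cardE))
  E-semilinear {suc (suc zero)}    cardE _    _    φ-semilinear _      = (λ x → x) , record
    { automorphism = identity-automorphism ; bijective = bijective ; additive = additive
    ; semilinear = additive-linear-over-two-elements cardE additive }
    where open IsSemilinearF φ-semilinear
  E-semilinear {suc (suc (suc k))} cardE arc₁ arc₂ φ-semilinear images = ArcFrame.semilinear cardE arc₁ arc₂ φ-semilinear images

  pseudo-oval-equivalence⇒oval-equivalence : ∀ {N} → Carrier ↔ Fin N → (O₁ O₂ : Fin (suc N) → V) →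
    IsArc O₁ → IsArc O₂ →
    SubspaceSetEquivalent (elementaryPseudoOval O₁) (elementaryPseudoOval O₂) → OvalEquivalent O₁ O₂
  pseudo-oval-equivalence⇒oval-equivalence cardE O₁ O₂ arc₁ arc₂ (σ , φ , φ-semilinearF , images , preimages) =
    proj₁ τ-semilinear , φ , proj₂ τ-semilinear
    , (λ i → proj₁ (images i) , same-point (proj₂ (images i)))
    , (λ j → proj₁ (preimages j) , same-point (proj₂ (preimages j)))
    where
    open IsSemilinearF φ-semilinearF
    τ-semilinear : ∃[ τ ] IsSemilinearE τ φ
    τ-semilinear = E-semilinear cardE arc₁ arc₂ φ-semilinearF images
    same-point : ∀ {i j} → MapsOnto φ (elementaryPseudoOval O₁ i) (elementaryPseudoOval O₂ j) → SamePoint (φ (O₁ i)) (O₂ j)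
    same-point {i} = AdditiveMap.maps-onto⇒same-point additive (proj₁ bijective) (IsArc.nonzero arc₁ i)

module Theorem (F E : Field) (ι : Field.Carrier F → Field.Carrier E) (ι-hom : IsFieldHom F E ι)
  {k N : ℕ} (cardF : Field.Carrier F ↔ Fin (2 ℕ.+ k)) (cardE : Field.Carrier E ↔ Fin N) where

  open Plane F E ι (FiniteField._≟_ E cardE)
  open PseudoOvalToOval F E ι (FiniteField._≟_ E cardE) using (pseudo-oval-equivalence⇒oval-equivalence)
  open OvalToPseudoOval F E ι ι-hom cardF (FiniteField._≟_ E cardE) using (oval-equivalence⇒pseudo-oval-equivalence)

  ArcTheorem : ℕ → Set
  ArcTheorem m = (O₁ O₂ : Fin m → V) → IsArc O₁ → IsArc O₂ →
    SubspaceSetEquivalent (elementaryPseudoOval O₁) (elementaryPseudoOval O₂) ⇔ OvalEquivalent O₁ O₂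

  arc-theorem : ArcTheorem (suc N)
  arc-theorem O₁ O₂ arc₁ arc₂ = mk⇔
    (pseudo-oval-equivalence⇒oval-equivalence cardE O₁ O₂ arc₁ arc₂)
    (oval-equivalence⇒pseudo-oval-equivalence O₁ O₂ (IsArc.nonzero arc₂))

open import Data.Nat using (ℕ; _+_; _^_; _≤_)
open import Data.Fin using (Fin)
open import Function.Bundles using (_↔_; _⇔_)

proposition1 : (q n : ℕ) → 1 ≤ n
    → (F : Field) → Field.Carrier F ↔ Fin q
    → (E : Field) → Field.Carrier E ↔ Fin (q ^ n)
    → (ι : Field.Carrier F → Field.Carrier E) → IsFieldHom F E ι
    → (O₁ O₂ : Fin (q ^ n + 1) → Geometry.V F E ι)
    → Geometry.IsOval F E ι q n O₁ → Geometry.IsOval F E ι q n O₂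
    → Geometry.SubspaceSetEquivalent F E ι
        (Geometry.elementaryPseudoOval F E ι O₁) (Geometry.elementaryPseudoOval F E ι O₂)
      ⇔ Geometry.OvalEquivalent F E ι O₁ O₂
proposition1 q n _ F cardF E cardE ι ι-hom O₁ O₂ oval₁ oval₂ =
  ≡.subst ArcTheorem (ℕ.+-comm 1 (q ^ n)) arc-theorem O₁ O₂ (oval⇒arc oval₁) (oval⇒arc oval₂)
  where
  q≡2+k : ∃[ k ] 2 + k ≡ q
  q≡2+k = ℕ.m≤n⇒∃[o]m+o≡n (FiniteField.size≥2 F cardF)
  open Theorem F E ι ι-hom (≡.subst (λ t → Field.Carrier F ↔ Fin t) (≡.sym (proj₂ q≡2+k)) cardF) cardE
  open Plane F E ι (FiniteField._≟_ E cardE) using (IsArc)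
  oval⇒arc : ∀ {O} → Geometry.IsOval F E ι q n O → IsArc O
  oval⇒arc oval = record { nonzero = nonzero ; distinct = distinct ; noThreeCol = noThreeCol }
    where open Geometry.IsOval oval
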